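{- Let $r$ be a positive integer, $\mathbb{K}$ a field containing a primitive $r$-th root of unity $z$, and $G=([\ell],E)$ a simple graph on $\ell$ vertices. Let $\mathcal{M}(G,r)$ be the arrangement in $\mathbb{K}^\ell$ $$\mathcal{M}(G,r)=\{\ker(x_i-z^kx_j)\mid \{i,j\}\in E,\ 1\le k\le r\}\cup\{\ker x_i\mid i\in[\ell]\}.$$ Then $$\chi(\mathcal{M}(G,r),t)=r^\ell\,\chi\!\left(G,\frac{t-1}{r}\right),$$ where $\chi(G,t)$ is the chromatic polynomial of $G$. In particular, $\chi(\mathcal{M}(G,r),t)$ is a polynomial in $r$ and $t$.
   Context: For a central arrangement $\mathcal{A}$ in $\mathbb{K}^\ell$, $\chi(\mathcal{A},t)=\sum_{\mathcal{B}\subseteq\mathcal{A}}(-1)^{|\mathcal{B}|}t^{\dim\bigcap_{H\in\mathcal{B}}H}$, with the empty intersection equal to $\mathbb{K}^\ell$. -}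

module Defs where

open import Level using (Level; _⊔_) renaming (suc to lsuc)
open import Algebra.Bundles using (CommutativeRing)
open import Data.Bool using (Bool; true; false; if_then_else_; _∧_; _∨_; not)
open import Data.Nat as ℕ using (ℕ; zero; suc; _<ᵇ_)
open import Data.Fin as Fin using (Fin; toℕ)
open import Data.Fin.Properties using () renaming (_≟_ to _≟ᶠ_)
open import Data.Integer as ℤ using (ℤ; +_)
open import Data.List using (List; []; _∷_; _++_; map; concatMap; filterᵇ; length; foldr; allFin; upTo)
open import Data.Bool.ListAction using (and)
open import Data.List.Relation.Unary.All using (All)
open import Data.Product using (Σ; _×_; _,_; ∃)
open import Relation.Binary.PropositionalEquality using (_≡_)
open import Relation.Nullary using (¬_; does)

record Field (a b : Level) : Set (lsuc (a ⊔ b)) where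
  field
    commutativeRing : CommutativeRing a b
  open CommutativeRing commutativeRing public
  field
    1≉0     : ¬ (1# ≈ 0#)
    inverse : ∀ x → ¬ (x ≈ 0#) → Σ Carrier λ y → (x * y) ≈ 1#

module _ {a b : Level} (F : Field a b) where
  open Field F

  pow : Carrier → ℕ → Carrier
  pow x zero    = 1#
  pow x (suc n) = x * pow x n

  PrimitiveRoot : ℕ → Carrier → Set b
  PrimitiveRoot r z =
    (pow z r ≈ 1#) × (∀ k → 1 ℕ.≤ k → k ℕ.< r → ¬ (pow z k ≈ 1#))

  -- vectors of K^ℓ (also used for linear forms, i.e. normal vectors of
  -- hyperplanes through the origin)
  Vec : ℕ → Set a
  Vec ℓ = Fin ℓ → Carrier

  Σᶠ : ∀ {n} → (Fin n → Carrier) → Carrier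
  Σᶠ {zero}  f = 0#
  Σᶠ {suc n} f = f Fin.zero + Σᶠ (λ i → f (Fin.suc i))

  dot : ∀ {ℓ} → Vec ℓ → Vec ℓ → Carrier
  dot α x = Σᶠ (λ m → α m * x m)

  e : ∀ {ℓ} → Fin ℓ → Vec ℓ
  e i m = if does (i ≟ᶠ m) then 1# else 0#

  InIntersection : ∀ {ℓ} → List (Vec ℓ) → Vec ℓ → Set (a ⊔ b)
  InIntersection B x = All (λ α → dot α x ≈ 0#) B

  IsDimOfIntersection : ∀ {ℓ} → List (Vec ℓ) → ℕ → Set (a ⊔ b)
  IsDimOfIntersection {ℓ} B d =
    Σ (Fin d → Vec ℓ) λ v →
      (∀ i → InIntersection B (v i))
    × (∀ (c : Fin d → Carrier) → (∀ m → Σᶠ (λ i → c i * v i m) ≈ 0#) → ∀ i → c i ≈ 0#)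
    × (∀ x → InIntersection B x → Σ (Fin d → Carrier) λ c → ∀ m → x m ≈ Σᶠ (λ i → c i * v i m))

record SimpleGraph (ℓ : ℕ) : Set where
  field
    adj    : Fin ℓ → Fin ℓ → Bool
    adj-sym   : ∀ i j → adj i j ≡ adj j i
    adj-irrefl : ∀ i → adj i i ≡ false

open SimpleGraph public

edges : ∀ {ℓ} → SimpleGraph ℓ → List (Fin ℓ × Fin ℓ)
edges {ℓ} G =
  concatMap (λ i → map (λ j → (i , j))
                       (filterᵇ (λ j → (toℕ i <ᵇ toℕ j) ∧ adj G i j) (allFin ℓ)))
            (allFin ℓ)

allFuns : (ℓ c : ℕ) → List (Fin ℓ → Fin c)
allFuns zero    c = (λ ()) ∷ []
allFuns (suc ℓ) c =
  concatMap (λ x → map (λ f → λ { Fin.zero → x ; (Fin.suc i) → f i }) (allFuns ℓ c))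
            (allFin c)

isProper : ∀ {ℓ c} → SimpleGraph ℓ → (Fin ℓ → Fin c) → Bool
isProper {ℓ} G f =
  and (concatMap (λ i → map (λ j → not (adj G i j) ∨ not (does (f i ≟ᶠ f j))) (allFin ℓ))
                 (allFin ℓ))

-- chromatic polynomial evaluated at a natural number c:
-- the number of proper colourings of G with c colours
chromaticAt : ∀ {ℓ} → SimpleGraph ℓ → ℕ → ℕ
chromaticAt {ℓ} G c = length (filterᵇ (isProper G) (allFuns ℓ c))

-- The arrangement M(G,r), as a list of normal vectors (one per hyperplane):
--   ker(x_i - z^k x_j) for {i,j} ∈ E, 1 ≤ k ≤ r,   and   ker x_i for i ∈ [ℓ].

module _ {a b : Level} (F : Field a b) where
  open Field F

  arrangementM : ∀ {ℓ} → SimpleGraph ℓ → (r : ℕ) → Carrier → List (Vec F ℓ)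
  arrangementM {ℓ} G r z =
    concatMap (λ { (i , j) → map (λ k → λ m → e F i m + (- (pow F z k * e F j m)))
                                 (map suc (upTo r)) })
              (edges G)
    ++ map (e F) (allFin ℓ)

-- all sub-collections (subsets, by position) of a list
sublists : ∀ {v} {A : Set v} → List A → List (List A)
sublists {A} [] = [] ∷ []
sublists {A} (x ∷ xs) = sublists xs ++ map (x ∷_) (sublists xs)

sumℤ : List ℤ → ℤ
sumℤ = foldr ℤ._+_ (+ 0)

charPolyAt : ∀ {v} {V : Set v} → List V → (List V → ℕ) → ℤ → ℤ
charPolyAt A dim t =
  sumℤ (map (λ B → ((ℤ.- (+ 1)) ℤ.^ length B) ℤ.* (t ℤ.^ dim B)) (sublists A))

{-# OPTIONS --safe #-}

-- The hyperplanes of M(G,r) read x_i = 0 and x_i = z^k x_j.  Gaussian elimination on any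
-- set of them keeps every coordinate of a solution of the form 0 or z^a y_p in terms of d
-- free parameters y_p, and it only uses that k ↦ (x ↦ z^k x) is an action of ℤ/r that is
-- free away from 0.  The set P = {0} ⊎ (ℤ/r × [c]) with ℤ/r acting on the first factor has
-- the same structure and r c + 1 points, so the same elimination shows that an intersection
-- of dimension d contains (r c + 1)^d points of P^ℓ.  Hence χ(M(G,r), r c + 1) is the
-- inclusion–exclusion count of the points of P^ℓ on no hyperplane of M(G,r): those with no
-- zero coordinate whose colours in [c] differ along the edges, i.e. r^ℓ χ(G,c) of them.

module Submission where

open import Defs
open import Data.Nat using (ℕ; NonZero)

module Summation where

  open import Level using (Level)
  open import Data.Bool using (true; false; if_then_else_)
  open import Data.Nat as ℕ using (ℕ; zero; suc)
  open import Data.Integer as ℤ using (ℤ; +_; _+_; _-_; _*_; -_; 0ℤ; 1ℤ)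
  import Data.Integer.Properties as ℤ
  open import Data.Integer.Tactic.RingSolver using (solve-∀)
  open import Algebra.Properties.CommutativeSemigroup ℤ.+-commutativeSemigroup using (interchange)
  open import Data.Product using (_×_; _,_)
  open import Data.List using (List; []; _∷_; _++_; map; concatMap; length; cartesianProduct; filter)
  open import Data.List.Relation.Unary.All using (all?)
  open import Function using (_∘_; _⇔_; Equivalence)
  open import Relation.Nullary using (Dec; yes; no; ¬_; ¬?; does; _×-dec_; contradiction)
  open import Relation.Unary using (Pred; Decidable)
  open import Relation.Binary.PropositionalEquality using (_≡_; refl; sym; trans; cong; cong₂; module ≡-Reasoning)

  private
    variable
      a b p q : Level
      A B : Set a

  ∑ : List A → (A → ℤ) → ℤ
  ∑ xs f = sumℤ (map f xs)

  syntax ∑ xs (λ x → e) = ∑[ x ∈ xs ] e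

  ∑-cong : ∀ (xs : List A) {f g : A → ℤ} → (∀ x → f x ≡ g x) → ∑ xs f ≡ ∑ xs g
  ∑-cong []       eq = refl
  ∑-cong (x ∷ xs) eq = cong₂ _+_ (eq x) (∑-cong xs eq)

  ∑-zero : ∀ (xs : List A) {f : A → ℤ} → (∀ x → f x ≡ 0ℤ) → ∑ xs f ≡ 0ℤ
  ∑-zero []       eq = refl
  ∑-zero (x ∷ xs) eq = cong₂ _+_ (eq x) (∑-zero xs eq)

  ∑-++ : ∀ (xs ys : List A) f → ∑ (xs ++ ys) f ≡ ∑ xs f + ∑ ys f
  ∑-++ []       ys f = sym (ℤ.+-identityˡ _)
  ∑-++ (x ∷ xs) ys f = trans (cong (_+_ (f x)) (∑-++ xs ys f)) (sym (ℤ.+-assoc (f x) _ _))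

  ∑-+ : ∀ (xs : List A) f g → ∑[ x ∈ xs ] (f x + g x) ≡ ∑ xs f + ∑ xs g
  ∑-+ []       f g = refl
  ∑-+ (x ∷ xs) f g = trans (cong (_+_ (f x + g x)) (∑-+ xs f g)) (interchange (f x) (g x) _ _)

  ∑-distribˡ : ∀ (xs : List A) k f → ∑[ x ∈ xs ] (k * f x) ≡ k * ∑ xs f
  ∑-distribˡ []       k f = sym (ℤ.*-zeroʳ k)
  ∑-distribˡ (x ∷ xs) k f =
    trans (cong (_+_ (k * f x)) (∑-distribˡ xs k f)) (sym (ℤ.*-distribˡ-+ k (f x) _))

  ∑-const : ∀ (xs : List A) k → ∑[ x ∈ xs ] k ≡ + length xs * k
  ∑-const []       k = refl
  ∑-const (x ∷ xs) k = begin
    k + ∑[ x ∈ xs ] k          ≡⟨ cong (_+_ k) (∑-const xs k) ⟩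
    k + + length xs * k        ≡⟨ cong (_+ + length xs * k) (ℤ.*-identityˡ k) ⟨
    1ℤ * k + + length xs * k   ≡⟨ ℤ.*-distribʳ-+ k 1ℤ (+ length xs) ⟨
    + suc (length xs) * k      ∎
    where open ≡-Reasoning

  ∑-map : ∀ (g : A → B) xs f → ∑ (map g xs) f ≡ ∑ xs (f ∘ g)
  ∑-map g []       f = refl
  ∑-map g (x ∷ xs) f = cong (_+_ (f (g x))) (∑-map g xs f)

  ∑-concatMap : ∀ (g : A → List B) xs f → ∑ (concatMap g xs) f ≡ ∑[ x ∈ xs ] ∑ (g x) f
  ∑-concatMap g []       f = refl
  ∑-concatMap g (x ∷ xs) f =
    trans (∑-++ (g x) (concatMap g xs) f) (cong (_+_ (∑ (g x) f)) (∑-concatMap g xs f))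

  ∑-comm : ∀ (xs : List A) (ys : List B) (f : A → B → ℤ) →
           ∑[ x ∈ xs ] ∑[ y ∈ ys ] f x y ≡ ∑[ y ∈ ys ] ∑[ x ∈ xs ] f x y
  ∑-comm []       ys f = sym (∑-zero ys (λ _ → refl))
  ∑-comm (x ∷ xs) ys f =
    trans (cong (_+_ (∑ ys (f x))) (∑-comm xs ys f)) (sym (∑-+ ys (f x) _))

  ∑-cartesianProduct : ∀ (xs : List A) (ys : List B) (f : A × B → ℤ) →
                       ∑ (cartesianProduct xs ys) f ≡ ∑[ x ∈ xs ] ∑[ y ∈ ys ] f (x , y)
  ∑-cartesianProduct []       ys f = refl
  ∑-cartesianProduct (x ∷ xs) ys f = begin
    ∑ (map (x ,_) ys ++ cartesianProduct xs ys) f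
      ≡⟨ ∑-++ (map (x ,_) ys) _ f ⟩
    ∑ (map (x ,_) ys) f + ∑ (cartesianProduct xs ys) f
      ≡⟨ cong₂ _+_ (∑-map (x ,_) ys f) (∑-cartesianProduct xs ys f) ⟩
    ∑[ y ∈ ys ] f (x , y) + ∑[ x ∈ xs ] ∑[ y ∈ ys ] f (x , y) ∎
    where open ≡-Reasoning

  pos-^ : ∀ m n → + (m ℕ.^ n) ≡ (+ m) ℤ.^ n
  pos-^ m zero    = refl
  pos-^ m (suc n) = trans (ℤ.pos-* m (m ℕ.^ n)) (cong (+ m *_) (pos-^ m n))

  𝟙 : {P : Set p} → Dec P → ℤ
  𝟙 P? = if does P? then 1ℤ else 0ℤ

  𝟙-⇔ : {P : Set p} {Q : Set q} (P? : Dec P) (Q? : Dec Q) → P ⇔ Q → 𝟙 P? ≡ 𝟙 Q?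
  𝟙-⇔ (yes _) (yes _) _   = refl
  𝟙-⇔ (no _)  (no _)  _   = refl
  𝟙-⇔ (yes P) (no ¬Q) P⇔Q = contradiction (Equivalence.to P⇔Q P) ¬Q
  𝟙-⇔ (no ¬P) (yes Q) P⇔Q = contradiction (Equivalence.from P⇔Q Q) ¬P

  𝟙-× : {P : Set p} {Q : Set q} (P? : Dec P) (Q? : Dec Q) → 𝟙 (P? ×-dec Q?) ≡ 𝟙 P? * 𝟙 Q?
  𝟙-× (yes _) Q? = sym (ℤ.*-identityˡ (𝟙 Q?))
  𝟙-× (no _)  Q? = refl

  𝟙-false : {P : Set p} (P? : Dec P) → ¬ P → 𝟙 P? ≡ 0ℤ
  𝟙-false (yes P) ¬P = contradiction P ¬P
  𝟙-false (no _)  ¬P = refl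

  𝟙-¬ : {P : Set p} (P? : Dec P) → 𝟙 (¬? P?) ≡ 1ℤ - 𝟙 P?
  𝟙-¬ (yes _) = refl
  𝟙-¬ (no _)  = refl

  ∑-𝟙 : ∀ {P : Pred A p} (P? : Decidable P) xs → ∑[ x ∈ xs ] 𝟙 (P? x) ≡ + length (filter P? xs)
  ∑-𝟙 P? []       = refl
  ∑-𝟙 P? (x ∷ xs) with does (P? x)
  ... | true  = cong (_+_ 1ℤ) (∑-𝟙 P? xs)
  ... | false = trans (ℤ.+-identityˡ _) (∑-𝟙 P? xs)

  sign : ℕ → ℤ
  sign n = (- 1ℤ) ℤ.^ n

  inclusion-exclusion : ∀ {P : Pred A p} (P? : Decidable P) xs →
    ∑[ S ∈ sublists xs ] (sign (length S) * 𝟙 (all? P? S)) ≡ 𝟙 (all? (¬? ∘ P?) xs)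
  inclusion-exclusion P? []       = refl
  inclusion-exclusion P? (x ∷ xs) = begin
    ∑ (sublists xs ++ map (x ∷_) (sublists xs)) term
      ≡⟨ ∑-++ (sublists xs) _ term ⟩
    ∑ (sublists xs) term + ∑ (map (x ∷_) (sublists xs)) term
      ≡⟨ cong₂ _+_ (inclusion-exclusion P? xs) (∑-map (x ∷_) (sublists xs) term) ⟩
    none + ∑[ S ∈ sublists xs ] (sign (suc (length S)) * 𝟙 (all? P? (x ∷ S)))
      ≡⟨ cong (_+_ none) (∑-cong (sublists xs) λ S →
           trans (cong (sign (suc (length S)) *_) (𝟙-× (P? x) (all? P? S)))
                 (sign-suc (sign (length S)) (𝟙 (P? x)) (𝟙 (all? P? S)))) ⟩
    none + ∑[ S ∈ sublists xs ] (- 𝟙 (P? x) * term S)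
      ≡⟨ cong (_+_ none) (trans (∑-distribˡ (sublists xs) (- 𝟙 (P? x)) term)
                               (cong (- 𝟙 (P? x) *_) (inclusion-exclusion P? xs))) ⟩
    none + - 𝟙 (P? x) * none
      ≡⟨ factor none (𝟙 (P? x)) ⟩
    (1ℤ - 𝟙 (P? x)) * none
      ≡⟨ cong (_* none) (𝟙-¬ (P? x)) ⟨
    𝟙 (¬? (P? x)) * none
      ≡⟨ 𝟙-× (¬? (P? x)) (all? (¬? ∘ P?) xs) ⟨
    𝟙 (all? (¬? ∘ P?) (x ∷ xs)) ∎
    where
    open ≡-Reasoning
    term : List _ → ℤ
    term S = sign (length S) * 𝟙 (all? P? S)
    none = 𝟙 (all? (¬? ∘ P?) xs)
    sign-suc : ∀ s i j → (- 1ℤ * s) * (i * j) ≡ - i * (s * j)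
    sign-suc = solve-∀
    factor : ∀ n i → n + - i * n ≡ (1ℤ - i) * n
    factor = solve-∀

module Enumeration where

  open import Level using (Level)
  open import Data.Nat as ℕ using (ℕ; zero; suc)
  open import Data.Integer as ℤ using (ℤ; +_; _+_; _*_; 1ℤ)
  import Data.Integer.Properties as ℤ
  open import Data.Fin using (zero; suc)
  open import Data.Fin.Properties using (_≟_)
  open import Data.Product using (_×_; _,_)
  import Data.Product.Properties as Product
  open import Data.Maybe using (just; nothing)
  import Data.Maybe.Properties as Maybe
  open import Data.List using (List; []; _∷_; [_]; map; concatMap; length; cartesianProduct; allFin; tabulate)
  import Data.List.Properties as List
  open import Data.Vec.Functional as Vector using (Vector; tail)
  import Data.Vec.Functional.Relation.Binary.Pointwise.Properties as Pointwise
  open import Function using (_∘_; _⇔_; mk⇔)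
  open import Relation.Binary using (Rel; Decidable; DecidableEquality)
  open import Relation.Nullary using (Dec; _×-dec_)
  open import Relation.Unary using (Pred)
  open import Relation.Binary.PropositionalEquality using (_≡_; refl; sym; trans; cong; cong₂; module ≡-Reasoning)
  open Summation

  private
    variable
      a b p q r s : Level
      A B : Set a

  Enumerates : {R : Rel A r} → Decidable R → List A → Set _
  Enumerates R? xs = ∀ a → ∑[ x ∈ xs ] 𝟙 (R? x a) ≡ 1ℤ

  length-allFin : ∀ n → length (allFin n) ≡ n
  length-allFin n = List.length-tabulate {n = n} (λ i → i)

  allFin-enumerates : ∀ n → Enumerates (_≟_ {n}) (allFin n)
  allFin-enumerates (suc n) j = trans (cong (_+_ (𝟙 (zero ≟ j))) (cong sumℤ tabulate-suc)) (count j)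
    where
    tabulate-suc : map (λ i → 𝟙 (i ≟ j)) (tabulate suc) ≡ map (λ i → 𝟙 (suc i ≟ j)) (allFin n)
    tabulate-suc = trans (List.map-tabulate suc _) (sym (List.map-tabulate (λ i → i) _))
    count : ∀ j → 𝟙 (zero ≟ j) + ∑[ i ∈ allFin n ] 𝟙 (suc i ≟ j) ≡ 1ℤ
    count zero    = cong (_+_ 1ℤ) (∑-zero (allFin n) (λ _ → refl))
    count (suc j) = trans (ℤ.+-identityˡ _) (allFin-enumerates n j)

  cartesianProduct-enumerates : ∀ {_≟A_ : DecidableEquality A} {_≟B_ : DecidableEquality B} xs ys →
    Enumerates _≟A_ xs → Enumerates _≟B_ ys → Enumerates (Product.≡-dec _≟A_ _≟B_) (cartesianProduct xs ys)
  cartesianProduct-enumerates {_≟A_ = _≟A_} {_≟B_} xs ys enumA enumB (a , b) = begin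
    ∑ (cartesianProduct xs ys) (λ xy → 𝟙 (_≟AB_ xy (a , b)))
      ≡⟨ ∑-cartesianProduct xs ys _ ⟩
    ∑[ x ∈ xs ] ∑[ y ∈ ys ] 𝟙 ((x , y) ≟AB (a , b))
      ≡⟨ ∑-cong xs (λ x → ∑-cong ys λ y → trans (𝟙-⇔ ((x , y) ≟AB (a , b)) (x ≟A a ×-dec y ≟B b) ,-≡⇔)
                                                 (𝟙-× (x ≟A a) (y ≟B b))) ⟩
    ∑[ x ∈ xs ] ∑[ y ∈ ys ] (𝟙 (x ≟A a) * 𝟙 (y ≟B b))
      ≡⟨ ∑-cong xs (λ x → ∑-distribˡ ys (𝟙 (x ≟A a)) (λ y → 𝟙 (y ≟B b))) ⟩
    ∑[ x ∈ xs ] (𝟙 (x ≟A a) * ∑[ y ∈ ys ] 𝟙 (y ≟B b))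
      ≡⟨ ∑-cong xs (λ x → trans (cong (𝟙 (x ≟A a) *_) (enumB b)) (ℤ.*-identityʳ _)) ⟩
    ∑[ x ∈ xs ] 𝟙 (x ≟A a)
      ≡⟨ enumA a ⟩
    1ℤ ∎
    where
    open ≡-Reasoning
    _≟AB_ = Product.≡-dec _≟A_ _≟B_
    ,-≡⇔ : ∀ {x y} → (x , y) ≡ (a , b) ⇔ (x ≡ a × y ≡ b)
    ,-≡⇔ = mk⇔ Product.,-injective (λ (x≡a , y≡b) → cong₂ _,_ x≡a y≡b)

  maybe-enumerates : ∀ {_≟A_ : DecidableEquality A} xs →
    Enumerates _≟A_ xs → Enumerates (Maybe.≡-dec _≟A_) (nothing ∷ map just xs)
  maybe-enumerates xs enum nothing  = cong (_+_ 1ℤ) (trans (∑-map just xs _) (∑-zero xs (λ _ → refl)))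
  maybe-enumerates xs enum (just a) = trans (ℤ.+-identityˡ _) (trans (∑-map just xs _) (enum a))

  length-cartesianProduct : ∀ (xs : List A) (ys : List B) →
                            length (cartesianProduct xs ys) ≡ length xs ℕ.* length ys
  length-cartesianProduct []       ys = refl
  length-cartesianProduct (x ∷ xs) ys = trans (List.length-++ (map (x ,_) ys))
    (cong₂ ℕ._+_ (List.length-map (x ,_) ys) (length-cartesianProduct xs ys))

  tuples : List A → (n : ℕ) → List (Vector A n)
  tuples xs zero    = [ Vector.[] ]
  tuples xs (suc n) = concatMap (λ x → map (x Vector.∷_) (tuples xs n)) xs

  length-tuples : ∀ (xs : List A) n → length (tuples xs n) ≡ length xs ℕ.^ n
  length-tuples xs zero    = refl
  length-tuples xs (suc n) = trans (length-prepend xs) (cong (length xs ℕ.*_) (length-tuples xs n))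
    where
    length-prepend : ∀ ys → length (concatMap (λ y → map (y Vector.∷_) (tuples xs n)) ys)
                            ≡ length ys ℕ.* length (tuples xs n)
    length-prepend []       = refl
    length-prepend (y ∷ ys) = trans (List.length-++ (map (y Vector.∷_) (tuples xs n)))
      (cong₂ ℕ._+_ (List.length-map (y Vector.∷_) (tuples xs n)) (length-prepend ys))

  ∑-tuples-suc : ∀ (xs : List A) n (h : Vector A (suc n) → ℤ) →
                 ∑ (tuples xs (suc n)) h ≡ ∑[ x ∈ xs ] ∑[ t ∈ tuples xs n ] h (x Vector.∷ t)
  ∑-tuples-suc xs n h = trans (∑-concatMap _ xs h) (∑-cong xs λ x → ∑-map (x Vector.∷_) (tuples xs n) h)

  tuples-enumerate : {R : Rel A r} (R? : Decidable R) (xs : List A) → Enumerates R? xs →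
                     ∀ n → Enumerates (Pointwise.decidable R? {n}) (tuples xs n)
  tuples-enumerate R? xs enum zero    y = refl
  tuples-enumerate R? xs enum (suc n) y = begin
    ∑[ t ∈ tuples xs (suc n) ] 𝟙 (R?ᵛ t y)
      ≡⟨ ∑-tuples-suc xs n _ ⟩
    ∑[ x ∈ xs ] ∑[ t ∈ ts ] 𝟙 (R?ᵛ (x Vector.∷ t) y)
      ≡⟨ ∑-cong xs (λ x → ∑-cong ts (split x)) ⟩
    ∑[ x ∈ xs ] ∑[ t ∈ ts ] (𝟙 (R? x (y zero)) * 𝟙 (R?ᵛ t (tail y)))
      ≡⟨ ∑-cong xs (λ x → ∑-distribˡ ts (𝟙 (R? x (y zero))) _) ⟩
    ∑[ x ∈ xs ] (𝟙 (R? x (y zero)) * ∑[ t ∈ ts ] 𝟙 (R?ᵛ t (tail y)))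
      ≡⟨ ∑-cong xs (λ x → trans (cong (𝟙 (R? x (y zero)) *_) (tuples-enumerate R? xs enum n (tail y)))
                                (ℤ.*-identityʳ _)) ⟩
    ∑[ x ∈ xs ] 𝟙 (R? x (y zero))
      ≡⟨ enum (y zero) ⟩
    1ℤ ∎
    where
    open ≡-Reasoning
    ts = tuples xs n
    R?ᵛ = Pointwise.decidable R?
    split : ∀ x t → 𝟙 (R?ᵛ (x Vector.∷ t) y) ≡ 𝟙 (R? x (y zero)) * 𝟙 (R?ᵛ t (tail y))
    split x t = trans (𝟙-⇔ (R?ᵛ (x Vector.∷ t) y) (R? x (y zero) ×-dec R?ᵛ t (tail y))
                        (mk⇔ (λ eq → eq zero , eq ∘ suc) λ { (eq , _) zero → eq ; (_ , eqs) (suc i) → eqs i }))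
                      (𝟙-× (R? x (y zero)) (R?ᵛ t (tail y)))

  count-by-parametrisation :
    ∀ {X : Set a} {Y : Set b} {_≈X_ : Rel X p} {_≈Y_ : Rel Y q}
    (≈X? : Decidable _≈X_) (≈Y? : Decidable _≈Y_) Xs Ys → Enumerates ≈X? Xs → Enumerates ≈Y? Ys →
    ∀ {S : Pred X s} (S? : ∀ x → Dec (S x)) (E : Y → X) (π : X → Y) →
    (∀ x y → x ≈X E y ⇔ (S x × y ≈Y π x)) →
    ∑[ x ∈ Xs ] 𝟙 (S? x) ≡ + length Ys
  count-by-parametrisation ≈X? ≈Y? Xs Ys enumX enumY S? E π E⇔ = begin
    ∑[ x ∈ Xs ] 𝟙 (S? x)                    ≡⟨ ∑-cong Xs fibre ⟩
    ∑[ x ∈ Xs ] ∑[ y ∈ Ys ] 𝟙 (≈X? x (E y)) ≡⟨ ∑-comm Xs Ys _ ⟩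
    ∑[ y ∈ Ys ] ∑[ x ∈ Xs ] 𝟙 (≈X? x (E y)) ≡⟨ ∑-cong Ys (enumX ∘ E) ⟩
    ∑[ y ∈ Ys ] 1ℤ                          ≡⟨ ∑-const Ys 1ℤ ⟩
    + length Ys * 1ℤ                        ≡⟨ ℤ.*-identityʳ _ ⟩
    + length Ys                             ∎
    where
    open ≡-Reasoning
    fibre : ∀ x → 𝟙 (S? x) ≡ ∑[ y ∈ Ys ] 𝟙 (≈X? x (E y))
    fibre x = begin
      𝟙 (S? x)                                  ≡⟨ ℤ.*-identityʳ _ ⟨
      𝟙 (S? x) * 1ℤ                             ≡⟨ cong (𝟙 (S? x) *_) (enumY (π x)) ⟨
      𝟙 (S? x) * ∑[ y ∈ Ys ] 𝟙 (≈Y? y (π x))    ≡⟨ ∑-distribˡ Ys (𝟙 (S? x)) _ ⟨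
      ∑[ y ∈ Ys ] (𝟙 (S? x) * 𝟙 (≈Y? y (π x)))  ≡⟨ ∑-cong Ys (λ y → 𝟙-× (S? x) (≈Y? y (π x))) ⟨
      ∑[ y ∈ Ys ] 𝟙 (S? x ×-dec ≈Y? y (π x))
        ≡⟨ ∑-cong Ys (λ y → 𝟙-⇔ (≈X? x (E y)) (S? x ×-dec ≈Y? y (π x)) (E⇔ x y)) ⟨
      ∑[ y ∈ Ys ] 𝟙 (≈X? x (E y))               ∎


module Equations where

  open import Level using (Level; _⊔_) renaming (suc to lsuc)
  open import Data.Nat using (ℕ; zero; suc; _+_; _*_; _<_; _%_; _/_; pred; NonZero; >-nonZero⁻¹)
  open import Data.Nat.Properties using (*-suc; +-comm; m+[n∸m]≡n; n≢0⇒n>0) renaming (_≟_ to _≟ℕ_)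
  open import Data.Nat.DivMod using (m≡m%n+[m/n]*n; m%n<n)
  open import Data.Fin using (Fin; punchIn; punchOut)
  open import Data.Fin.Properties using (_≟_; punchInᵢ≢i; punchIn-punchOut; punchOut-cong; punchOut-punchIn)
  open import Data.Maybe using (Maybe; just; nothing)
  open import Data.Product using (∃; _×_; _,_; proj₁; proj₂)
  open import Data.List using (List; []; _∷_)
  open import Data.List.Relation.Unary.All using (All; []; _∷_)
  open import Data.Unit.Polymorphic using (⊤)
  open import Function using (_∘_; id; _⇔_; mk⇔; Equivalence)
  open import Function.Construct.Composition using (_⇔-∘_)
  open import Relation.Binary using (Setoid)
  open import Relation.Nullary using (yes; no; contradiction)
  open import Relation.Binary.PropositionalEquality as ≡ using (_≡_; _≢_)

  -- coord i stands for ker x_i and edge i j k for ker (x_i - z^k x_j).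
  data Hyperplane (ℓ : ℕ) : Set where
    coord : Fin ℓ → Hyperplane ℓ
    edge  : Fin ℓ → Fin ℓ → ℕ → Hyperplane ℓ

  -- The structure of K seen through the equations x_i = 0 and x_i = z^k x_j:
  -- an action of ℤ/r (k · x standing for z^k x) that is free away from the fixed point 0.
  record CyclicAction (r : ℕ) (c ℓ : Level) : Set (lsuc (c ⊔ ℓ)) where
    infixr 7 _·_
    field
      setoid : Setoid c ℓ
    open Setoid setoid public
    field
      origin     : Carrier
      _·_        : ℕ → Carrier → Carrier
      ·-cong     : ∀ k {x y} → x ≈ y → k · x ≈ k · y
      ·-identity : ∀ x → 0 · x ≈ x
      ·-assoc    : ∀ m n x → m · (n · x) ≈ (m + n) · x
      ·-period   : ∀ x → r · x ≈ x
      ·-origin   : ∀ k → k · origin ≈ origin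
      ·-free     : ∀ {k x} → 0 < k → k < r → k · x ≈ x → x ≈ origin

  module Elimination (r : ℕ) .{{_ : NonZero r}} where

    neg : ℕ → ℕ
    neg a = a * pred r

    +-neg : ∀ a → a + neg a ≡ a * r
    +-neg a = ≡.trans (≡.sym (*-suc a (pred r))) (≡.cong (a *_) (m+[n∸m]≡n (>-nonZero⁻¹ r)))

    -- nothing stands for 0 and just (p , a) for a · y_p, in terms of free parameters y.
    Monomial : ℕ → Set
    Monomial d = Maybe (Fin d × ℕ)

    _·ᵐ_ : ∀ {d} → ℕ → Monomial d → Monomial d
    k ·ᵐ nothing      = nothing
    k ·ᵐ just (p , a) = just (p , k + a)

    substitute : ∀ {d} → Fin (suc d) → Monomial d → Monomial (suc d) → Monomial d
    substitute q v nothing = nothing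
    substitute q v (just (s , a)) with q ≟ s
    ... | yes _   = a ·ᵐ v
    ... | no q≢s = just (punchOut q≢s , a)

    substitute-self : ∀ {d} (q : Fin (suc d)) v → substitute q v (just (q , 0)) ≡ 0 ·ᵐ v
    substitute-self q v with q ≟ q
    ... | yes _  = ≡.refl
    ... | no q≢q = contradiction ≡.refl q≢q

    substitute-punchIn : ∀ {d} (q : Fin (suc d)) v p → substitute q v (just (punchIn q p , 0)) ≡ just (p , 0)
    substitute-punchIn q v p with q ≟ punchIn q p
    ... | yes q≡ = contradiction (≡.sym q≡) (punchInᵢ≢i q p)
    ... | no q≢ = ≡.cong (λ s → just (s , 0)) (≡.trans (punchOut-cong q ≡.refl) (punchOut-punchIn q))

    -- The solutions are the x with x_m given by coeff m at the free parameters y_p = x_(pivot p).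
    record Echelon (ℓ d : ℕ) : Set where
      field
        coeff       : Fin ℓ → Monomial d
        pivot       : Fin d → Fin ℓ
        coeff-pivot : ∀ p → coeff (pivot p) ≡ just (p , 0)
    open Echelon public

    eliminate : ∀ {ℓ d} → Echelon ℓ (suc d) → Fin (suc d) → Monomial d → Echelon ℓ d
    eliminate E q v = record
      { coeff       = substitute q v ∘ coeff E
      ; pivot       = pivot E ∘ punchIn q
      ; coeff-pivot = λ p → ≡.trans (≡.cong (substitute q v) (coeff-pivot E (punchIn q p)))
                                    (substitute-punchIn q v p)
      }

    -- q ≔ v is the equation y_q = v, with v written in the parameters other than q.
    data Constraint : ℕ → Set where
      trivial : ∀ {d} → Constraint d
      _≔_     : ∀ {d} → Fin (suc d) → Monomial d → Constraint (suc d)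

    impose : ∀ {ℓ d} → Echelon ℓ d → Constraint d → ∃ (Echelon ℓ)
    impose E trivial = _ , E
    impose E (q ≔ v) = _ , eliminate E q v

    vanishing : ∀ {d} → Monomial d → Constraint d
    vanishing         nothing       = trivial
    vanishing {zero}  (just (() , _))
    vanishing {suc d} (just (p , _)) = p ≔ nothing

    proportional : ∀ {d} → ℕ → Monomial d → Monomial d → Constraint d
    proportional k nothing w       = vanishing w
    proportional k u       nothing = vanishing u
    proportional {zero}  k (just (() , _)) (just _)
    proportional {suc d} k (just (p , a)) (just (q , b)) with p ≟ q
    ... | no p≢q = q ≔ just (punchOut (p≢q ∘ ≡.sym) , neg (k + b) + a)
    -- a · y_p = (k + b) · y_p holds always or only for y_p = 0, according to a - (k + b) mod r
    ... | yes _ with (neg (k + b) + a) % r ≟ℕ 0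
    ...   | yes _ = trivial
    ...   | no _  = p ≔ nothing

    constraint : ∀ {ℓ d} → Echelon ℓ d → Hyperplane ℓ → Constraint d
    constraint E (coord i)    = vanishing (coeff E i)
    constraint E (edge i j k) = proportional k (coeff E i) (coeff E j)

    initial : ∀ ℓ → Echelon ℓ ℓ
    initial ℓ = record { coeff = λ i → just (i , 0) ; pivot = id ; coeff-pivot = λ _ → ≡.refl }

    run : ∀ {ℓ} → List (Hyperplane ℓ) → ∃ (Echelon ℓ)
    run {ℓ} []      = ℓ , initial ℓ
    run     (h ∷ S) = let _ , E = run S in impose E (constraint E h)

    rank : ∀ {ℓ} → List (Hyperplane ℓ) → ℕ
    rank S = proj₁ (run S)

    module ActionProperties {c ℓ′} (A : CyclicAction r c ℓ′) where
      open CyclicAction A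
      open import Relation.Binary.Reasoning.Setoid setoid

      ·-multiple : ∀ n x → (n * r) · x ≈ x
      ·-multiple zero    x = ·-identity x
      ·-multiple (suc n) x = begin
        (r + n * r) · x   ≈⟨ ·-assoc r (n * r) x ⟨
        r · (n * r) · x   ≈⟨ ·-cong r (·-multiple n x) ⟩
        r · x             ≈⟨ ·-period x ⟩
        x                 ∎

      ·-mod : ∀ a x → a · x ≈ (a % r) · x
      ·-mod a x = begin
        a · x                       ≡⟨ ≡.cong (_· x) (m≡m%n+[m/n]*n a r) ⟩
        (a % r + a / r * r) · x     ≈⟨ ·-assoc (a % r) (a / r * r) x ⟨
        (a % r) · (a / r * r) · x   ≈⟨ ·-cong (a % r) (·-multiple (a / r) x) ⟩
        (a % r) · x                 ∎

      ·-neg : ∀ a x → a · neg a · x ≈ x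
      ·-neg a x = begin
        a · neg a · x     ≈⟨ ·-assoc a (neg a) x ⟩
        (a + neg a) · x   ≡⟨ ≡.cong (_· x) (+-neg a) ⟩
        (a * r) · x       ≈⟨ ·-multiple a x ⟩
        x                 ∎

      neg-· : ∀ a x → neg a · a · x ≈ x
      neg-· a x = begin
        neg a · a · x     ≈⟨ ·-assoc (neg a) a x ⟩
        (neg a + a) · x   ≡⟨ ≡.cong (_· x) (+-comm (neg a) a) ⟩
        (a + neg a) · x   ≈⟨ ·-assoc a (neg a) x ⟨
        a · neg a · x     ≈⟨ ·-neg a x ⟩
        x                 ∎

      ·-injective : ∀ a {x y} → a · x ≈ a · y → x ≈ y
      ·-injective a {x} {y} eq = begin
        x               ≈⟨ neg-· a x ⟨
        neg a · a · x   ≈⟨ ·-cong (neg a) eq ⟩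
        neg a · a · y   ≈⟨ neg-· a y ⟩
        y               ∎

      ·≈origin⇔ : ∀ a x → a · x ≈ origin ⇔ x ≈ origin
      ·≈origin⇔ a x = mk⇔ (λ eq → ·-injective a (trans eq (sym (·-origin a))))
                          (λ eq → trans (·-cong a eq) (·-origin a))

      ·-solve : ∀ a b x y → a · x ≈ b · y ⇔ y ≈ (neg b + a) · x
      ·-solve a b x y = mk⇔
        (λ eq → begin
          y                     ≈⟨ neg-· b y ⟨
          neg b · b · y         ≈⟨ ·-cong (neg b) eq ⟨
          neg b · a · x         ≈⟨ ·-assoc (neg b) a x ⟩
          (neg b + a) · x       ∎)
        (λ eq → begin
          a · x                 ≈⟨ ·-neg b (a · x) ⟨
          b · neg b · a · x     ≈⟨ ·-cong b (·-assoc (neg b) a x) ⟩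
          b · (neg b + a) · x   ≈⟨ ·-cong b eq ⟨
          b · y                 ∎)

      fixed : ∀ a x → a % r ≡ 0 → x ≈ a · x
      fixed a x a≡0 = sym (begin
        a · x         ≈⟨ ·-mod a x ⟩
        (a % r) · x   ≡⟨ ≡.cong (_· x) a≡0 ⟩
        0 · x         ≈⟨ ·-identity x ⟩
        x             ∎)

      fixed⇔ : ∀ a x → a % r ≢ 0 → x ≈ a · x ⇔ x ≈ origin
      fixed⇔ a x a≢0 = mk⇔
        (λ eq → ·-free (n≢0⇒n>0 a≢0) (m%n<n a r) (sym (trans eq (·-mod a x))))
        (λ eq → trans eq (trans (sym (·-origin a)) (·-cong a (sym eq))))

      ≈⇔≈ : ∀ {x x′ y y′} → x ≈ x′ → y ≈ y′ → x ≈ y ⇔ x′ ≈ y′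
      ≈⇔≈ x≈x′ y≈y′ = mk⇔ (λ eq → trans (sym x≈x′) (trans eq y≈y′))
                          (λ eq → trans x≈x′ (trans eq (sym y≈y′)))

    module Solutions {c ℓ′} (A : CyclicAction r c ℓ′) where
      open CyclicAction A
      open ActionProperties A
      open import Relation.Binary.Reasoning.Setoid setoid

      ⟦_⟧ : ∀ {d} → Monomial d → (Fin d → Carrier) → Carrier
      ⟦ nothing ⟧      y = origin
      ⟦ just (p , a) ⟧ y = a · y p

      ⟦⟧-cong : ∀ {d} (u : Monomial d) {y y′} → (∀ p → y p ≈ y′ p) → ⟦ u ⟧ y ≈ ⟦ u ⟧ y′
      ⟦⟧-cong nothing        eq = refl
      ⟦⟧-cong (just (p , a)) eq = ·-cong a (eq p)

      ⟦·ᵐ⟧ : ∀ {d} k (v : Monomial d) y → ⟦ k ·ᵐ v ⟧ y ≈ k · ⟦ v ⟧ y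
      ⟦·ᵐ⟧ k nothing        y = sym (·-origin k)
      ⟦·ᵐ⟧ k (just (p , a)) y = sym (·-assoc k a (y p))

      substitute-correct : ∀ {d} q (v : Monomial d) u y →
                           y q ≈ ⟦ v ⟧ (y ∘ punchIn q) → ⟦ substitute q v u ⟧ (y ∘ punchIn q) ≈ ⟦ u ⟧ y
      substitute-correct q v nothing        y eq = refl
      substitute-correct q v (just (s , a)) y eq with q ≟ s
      ... | yes ≡.refl = trans (⟦·ᵐ⟧ a v _) (·-cong a (sym eq))
      ... | no q≢s   = reflexive (≡.cong (λ t → a · y t) (punchIn-punchOut q≢s))

      Holds : ∀ {d} → Constraint d → (Fin d → Carrier) → Set ℓ′
      Holds trivial y = ⊤
      Holds (q ≔ v) y = y q ≈ ⟦ v ⟧ (y ∘ punchIn q)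

      Solves : ∀ {ℓ d} → Echelon ℓ d → (Fin ℓ → Carrier) → Set ℓ′
      Solves E x = ∀ m → x m ≈ ⟦ coeff E m ⟧ (x ∘ pivot E)

      eliminate-correct : ∀ {ℓ d} (E : Echelon ℓ (suc d)) q v x →
                          Solves (eliminate E q v) x ⇔ (Solves E x × Holds (q ≔ v) (x ∘ pivot E))
      eliminate-correct E q v x = mk⇔ to from
        where
        y = x ∘ pivot E
        y′ = y ∘ punchIn q
        from : Solves E x × Holds (q ≔ v) y → Solves (eliminate E q v) x
        from (sol , eq) m = trans (sol m) (sym (substitute-correct q v (coeff E m) y eq))
        to : Solves (eliminate E q v) x → Solves E x × Holds (q ≔ v) y
        to sol = (λ m → trans (sol m) (substitute-correct q v (coeff E m) y eq)) , eq
          where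
          eq : y q ≈ ⟦ v ⟧ y′
          eq = begin
            y q                                          ≈⟨ sol (pivot E q) ⟩
            ⟦ substitute q v (coeff E (pivot E q)) ⟧ y′   ≡⟨ ≡.cong (λ u → ⟦ substitute q v u ⟧ y′) (coeff-pivot E q) ⟩
            ⟦ substitute q v (just (q , 0)) ⟧ y′          ≡⟨ ≡.cong (λ u → ⟦ u ⟧ y′) (substitute-self q v) ⟩
            ⟦ 0 ·ᵐ v ⟧ y′                                 ≈⟨ ⟦·ᵐ⟧ 0 v y′ ⟩
            0 · ⟦ v ⟧ y′                                  ≈⟨ ·-identity _ ⟩
            ⟦ v ⟧ y′                                      ∎

      impose-correct : ∀ {ℓ d} (E : Echelon ℓ d) c x →
                       Solves (proj₂ (impose E c)) x ⇔ (Solves E x × Holds c (x ∘ pivot E))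
      impose-correct E trivial x = mk⇔ (_, _) proj₁
      impose-correct E (q ≔ v) x = eliminate-correct E q v x

      vanishing-correct : ∀ {d} (u : Monomial d) y → ⟦ u ⟧ y ≈ origin ⇔ Holds (vanishing u) y
      vanishing-correct         nothing        y = mk⇔ _ (λ _ → refl)
      vanishing-correct {suc d} (just (p , a)) y = ·≈origin⇔ a (y p)

      proportional-correct : ∀ {d} k (u w : Monomial d) y →
                             ⟦ u ⟧ y ≈ k · ⟦ w ⟧ y ⇔ Holds (proportional k u w) y
      proportional-correct k nothing w y =
        vanishing-correct w y ⇔-∘ (·≈origin⇔ k (⟦ w ⟧ y) ⇔-∘ mk⇔ sym sym)
      proportional-correct k (just (p , a)) nothing y =
        vanishing-correct (just (p , a)) y ⇔-∘ ≈⇔≈ refl (·-origin k)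
      proportional-correct {suc d} k (just (p , a)) (just (q , b)) y with p ≟ q
      ... | no p≢q =
        ≈⇔≈ refl (·-cong (neg (k + b) + a) (reflexive (≡.cong y (≡.sym (punchIn-punchOut (p≢q ∘ ≡.sym))))))
          ⇔-∘ (·-solve a (k + b) (y p) (y q) ⇔-∘ ≈⇔≈ refl (·-assoc k b (y q)))
      ... | yes ≡.refl with (neg (k + b) + a) % r ≟ℕ 0
      ...   | yes ≡0 = mk⇔ _ (λ _ → Equivalence.from (·-solve a (k + b) (y p) (y p)) (fixed _ (y p) ≡0))
                         ⇔-∘ ≈⇔≈ refl (·-assoc k b (y p))
      ...   | no ≢0  =
        fixed⇔ _ (y p) ≢0 ⇔-∘ (·-solve a (k + b) (y p) (y p) ⇔-∘ ≈⇔≈ refl (·-assoc k b (y p)))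

      OnHyperplane : ∀ {ℓ} → Hyperplane ℓ → (Fin ℓ → Carrier) → Set ℓ′
      OnHyperplane (coord i)    x = x i ≈ origin
      OnHyperplane (edge i j k) x = x i ≈ k · x j

      constraint-correct : ∀ {ℓ d} (E : Echelon ℓ d) {x} → Solves E x →
                           ∀ h → OnHyperplane h x ⇔ Holds (constraint E h) (x ∘ pivot E)
      constraint-correct E {x} sol (coord i) =
        vanishing-correct (coeff E i) (x ∘ pivot E) ⇔-∘ ≈⇔≈ (sol i) refl
      constraint-correct E {x} sol (edge i j k) =
        proportional-correct k (coeff E i) (coeff E j) (x ∘ pivot E) ⇔-∘ ≈⇔≈ (sol i) (·-cong k (sol j))

      step-correct : ∀ {ℓ d} (E : Echelon ℓ d) h x →
                     Solves (proj₂ (impose E (constraint E h))) x ⇔ (Solves E x × OnHyperplane h x)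
      step-correct E h x = mk⇔
        (λ s → let sol , holds = Equivalence.to (impose-correct E (constraint E h) x) s
               in sol , Equivalence.from (constraint-correct E sol h) holds)
        (λ (sol , on) → Equivalence.from (impose-correct E (constraint E h) x)
                                         (sol , Equivalence.to (constraint-correct E sol h) on))

      run-correct : ∀ {ℓ} (S : List (Hyperplane ℓ)) x →
                    Solves (proj₂ (run S)) x ⇔ All (λ h → OnHyperplane h x) S
      run-correct []      x = mk⇔ (λ _ → []) (λ _ m → sym (·-identity (x m)))
      run-correct (h ∷ S) x = mk⇔
        (λ s → let sol , on = Equivalence.to (step-correct _ h x) s in on ∷ Equivalence.to (run-correct S x) sol)
        (λ { (on ∷ ons) → Equivalence.from (step-correct _ h x) (Equivalence.from (run-correct S x) ons , on) })

      expand : ∀ {ℓ d} → Echelon ℓ d → (Fin d → Carrier) → Fin ℓ → Carrier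
      expand E y m = ⟦ coeff E m ⟧ y

      expand-pivot : ∀ {ℓ d} (E : Echelon ℓ d) y p → expand E y (pivot E p) ≈ y p
      expand-pivot E y p = trans (reflexive (≡.cong (λ u → ⟦ u ⟧ y) (coeff-pivot E p))) (·-identity (y p))

      solves-expand : ∀ {ℓ d} (E : Echelon ℓ d) y → Solves E (expand E y)
      solves-expand E y m = ⟦⟧-cong (coeff E m) (λ p → sym (expand-pivot E y p))

      ≈expand⇔ : ∀ {ℓ d} (E : Echelon ℓ d) x y →
                 (∀ m → x m ≈ expand E y m) ⇔ (Solves E x × ∀ p → y p ≈ x (pivot E p))
      ≈expand⇔ E x y = mk⇔
        (λ eq → let y≈ = λ p → trans (sym (expand-pivot E y p)) (sym (eq (pivot E p)))
                in (λ m → trans (eq m) (⟦⟧-cong (coeff E m) y≈)) , y≈)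
        (λ (sol , y≈) m → trans (sol m) (⟦⟧-cong (coeff E m) (sym ∘ y≈)))


open Equations

module LinearAlgebra {a b} (F : Field a b) where

  open import Level using (_⊔_)
  open import Data.Nat using (zero; suc; _≤_; _≤?_; z≤n; s≤s)
  open import Data.Nat.Properties using (m≤n⇒m≤1+n)
  open import Data.Fin using (Fin; zero; suc; punchIn)
  open import Data.Product using (∃; _,_)
  open import Data.Sum using (_⊎_; inj₁; inj₂)
  open import Data.Vec.Functional using (insertAt)
  open import Data.Vec.Functional.Properties using (insertAt-lookup; insertAt-punchIn)
  open import Function using (_∘_)
  open import Relation.Nullary using (¬_)
  open import Relation.Nullary.Decidable using (decidable-stable)
  open import Relation.Binary.PropositionalEquality as ≡ using (_≡_)
  open Field F hiding (zero)
  open import Algebra.Properties.Semiring.Sum semiring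
  open import Algebra.Properties.Ring ring using (-‿distribˡ-*; -‿distribʳ-*)
  open import Relation.Binary.Reasoning.Setoid setoid

  ¬¬-all⊎counterexample : ∀ {ℓ} n (Q : Fin n → Set ℓ) → ¬ ¬ ((∀ i → Q i) ⊎ ∃ λ i → ¬ Q i)
  ¬¬-all⊎counterexample zero    Q k = k (inj₁ λ ())
  ¬¬-all⊎counterexample (suc n) Q k = ¬¬-all⊎counterexample n (Q ∘ suc) λ where
    (inj₂ (i , ¬q)) → k (inj₂ (suc i , ¬q))
    (inj₁ Q-suc)    → k (inj₂ (zero , λ q → k (inj₁ λ { zero → q ; (suc i) → Q-suc i })))

  Σᶠ≡sum : ∀ {n} (f : Fin n → Carrier) → Σᶠ F f ≡ sum f
  Σᶠ≡sum {zero}  f = ≡.refl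
  Σᶠ≡sum {suc n} f = ≡.cong (f zero +_) (Σᶠ≡sum (f ∘ suc))

  dot≡sum : ∀ {n} (α x : Vec F n) → dot F α x ≡ ∑[ m < n ] (α m * x m)
  dot≡sum α x = Σᶠ≡sum (λ m → α m * x m)

  sum-zero : ∀ {n} {f : Fin n → Carrier} → (∀ i → f i ≈ 0#) → sum f ≈ 0#
  sum-zero {n} f≈0 = trans (sum-cong-≋ f≈0) (sum-replicate-zero n)

  sum-e : ∀ {n} (i : Fin n) (x : Fin n → Carrier) → ∑[ m < n ] (e F i m * x m) ≈ x i
  sum-e zero    x = trans (+-cong (*-identityˡ (x zero)) (sum-zero (λ m → zeroˡ (x (suc m))))) (+-identityʳ _)
  sum-e (suc i) x = trans (+-cong (zeroˡ (x zero)) (sum-e i (x ∘ suc))) (+-identityˡ _)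

  nonzero-cancel : ∀ {d x} → ¬ d ≈ 0# → d * x ≈ 0# → x ≈ 0#
  nonzero-cancel {d} {x} d≉0 dx≈0 with inverse d d≉0
  ... | w , dw≈1 = begin
    x             ≈⟨ *-identityˡ x ⟨
    1# * x        ≈⟨ *-congʳ (trans (sym dw≈1) (*-comm d w)) ⟩
    (w * d) * x   ≈⟨ *-assoc w d x ⟩
    w * (d * x)   ≈⟨ *-congˡ dx≈0 ⟩
    w * 0#        ≈⟨ zeroʳ w ⟩
    0#            ∎

  Independent : ∀ {n m} → (Fin n → Fin m → Carrier) → Set (a ⊔ b)
  Independent {n} u = ∀ (c : Fin n → Carrier) → (∀ j → ∑[ i < n ] (c i * u i j) ≈ 0#) → ∀ i → c i ≈ 0#

  independent-tail : ∀ {n m} (u : Fin n → Fin (suc m) → Carrier) →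
                     (∀ i → u i zero ≈ 0#) → Independent u → Independent (λ i → u i ∘ suc)
  independent-tail u col≈0 ind c c·u≈0 = ind c λ where
    zero    → sum-zero (λ i → trans (*-congˡ (col≈0 i)) (zeroʳ (c i)))
    (suc j) → c·u≈0 j

  -- eliminates the first column using row k as pivot, w being the inverse of u k zero
  clear : ∀ {n m} → (Fin (suc n) → Fin (suc m) → Carrier) → Fin (suc n) → Carrier → Fin n → Fin m → Carrier
  clear u k w i j = u (punchIn k i) (suc j) - (u (punchIn k i) zero * w) * u k (suc j)

  -- A relation c among the cleared rows extends, by the coefficient t at row k, to one among the rows of u.
  independent-clear : ∀ {n m} (u : Fin (suc n) → Fin (suc m) → Carrier) k w → u k zero * w ≈ 1# →
                      Independent u → Independent (clear u k w)
  independent-clear {n} u k w uw≈1 ind c c·u′≈0 i = begin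
    c i                           ≡⟨ insertAt-punchIn c k t i ⟨
    insertAt c k t (punchIn k i)  ≈⟨ ind (insertAt c k t) extended≈0 (punchIn k i) ⟩
    0#                            ∎
    where
    s : Carrier
    s = ∑[ i < n ] (c i * u (punchIn k i) zero)
    t : Carrier
    t = - (s * w)
    t*≈ : ∀ x → t * x ≈ s * - (w * x)
    t*≈ x = begin
      - (s * w) * x     ≈⟨ -‿distribˡ-* (s * w) x ⟨
      - ((s * w) * x)   ≈⟨ -‿cong (*-assoc s w x) ⟩
      - (s * (w * x))   ≈⟨ -‿distribʳ-* s (w * x) ⟩
      s * - (w * x)     ∎
    extended : ∀ j → ∑[ x < suc n ] (insertAt c k t x * u x j) ≈ t * u k j + ∑[ i < n ] (c i * u (punchIn k i) j)
    extended j = trans (sum-remove {i = k} (λ x → insertAt c k t x * u x j))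
                       (+-cong (*-congʳ (reflexive (insertAt-lookup c k t)))
                               (sum-cong-≋ λ i → *-congʳ (reflexive (insertAt-punchIn c k t i))))
    extended≈0 : ∀ j → ∑[ x < suc n ] (insertAt c k t x * u x j) ≈ 0#
    extended≈0 zero = begin
      _                          ≈⟨ extended zero ⟩
      t * u k zero + s           ≈⟨ +-congʳ (t*≈ (u k zero)) ⟩
      s * - (w * u k zero) + s   ≈⟨ +-congʳ (*-congˡ (-‿cong (trans (*-comm w _) uw≈1))) ⟩
      s * - 1# + s               ≈⟨ +-congʳ (trans (sym (-‿distribʳ-* s 1#)) (-‿cong (*-identityʳ s))) ⟩
      - s + s                    ≈⟨ -‿inverseˡ s ⟩
      0#                         ∎
    extended≈0 (suc j) = begin
      _                                                        ≈⟨ extended (suc j) ⟩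
      t * C + ∑[ i < n ] (c i * A i)                           ≈⟨ +-comm _ _ ⟩
      ∑[ i < n ] (c i * A i) + t * C                           ≈⟨ +-congˡ (t*≈ C) ⟩
      ∑[ i < n ] (c i * A i) + s * - (w * C)
        ≈⟨ +-congˡ (*-distribʳ-sum (- (w * C)) (λ i → c i * B i)) ⟩
      ∑[ i < n ] (c i * A i) + ∑[ i < n ] ((c i * B i) * - (w * C))
        ≈⟨ ∑-distrib-+ (λ i → c i * A i) (λ i → (c i * B i) * - (w * C)) ⟨
      ∑[ i < n ] (c i * A i + (c i * B i) * - (w * C))         ≈⟨ sum-cong-≋ (λ i → sym (row i)) ⟩
      ∑[ i < n ] (c i * clear u k w i j)                       ≈⟨ c·u′≈0 j ⟩
      0#                                                       ∎
      where
      A B : Fin n → Carrier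
      A i = u (punchIn k i) (suc j)
      B i = u (punchIn k i) zero
      C = u k (suc j)
      row : ∀ i → c i * clear u k w i j ≈ c i * A i + (c i * B i) * - (w * C)
      row i = begin
        c i * (A i - (B i * w) * C)            ≈⟨ distribˡ (c i) (A i) _ ⟩
        c i * A i + c i * - ((B i * w) * C)    ≈⟨ +-congˡ (-‿distribʳ-* (c i) _) ⟨
        c i * A i + - (c i * ((B i * w) * C))  ≈⟨ +-congˡ (-‿cong (*-congˡ (*-assoc (B i) w C))) ⟩
        c i * A i + - (c i * (B i * (w * C)))  ≈⟨ +-congˡ (-‿cong (*-assoc (c i) (B i) _)) ⟨
        c i * A i + - ((c i * B i) * (w * C))  ≈⟨ +-congˡ (-‿distribʳ-* (c i * B i) _) ⟩
        c i * A i + (c i * B i) * - (w * C)    ∎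

  -- Whether a column vanishes cannot be decided, but n ≤ m can, so refuting n ≰ m is enough.
  ¬¬-independent⇒≤ : ∀ m {n} (u : Fin n → Fin m → Carrier) → Independent u → ¬ ¬ (n ≤ m)
  ¬¬-independent⇒≤ zero    {zero}  u ind = λ ¬0≤0 → ¬0≤0 z≤n
  ¬¬-independent⇒≤ zero    {suc n} u ind = λ _ → 1≉0 (ind (λ _ → 1#) (λ ()) zero)
  ¬¬-independent⇒≤ (suc m) {n} u ind ¬n≤m = ¬¬-all⊎counterexample n (λ i → u i zero ≈ 0#) split
    where
    with-pivot : ∀ {n} (u : Fin n → Fin (suc m) → Carrier) → Independent u →
                 ∀ k → ¬ u k zero ≈ 0# → ¬ ¬ (n ≤ suc m)
    with-pivot {suc n} u ind k uk≉0 with inverse (u k zero) uk≉0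
    ... | w , uw≈1 = λ ¬n≤m →
      ¬¬-independent⇒≤ m (clear u k w) (independent-clear u k w uw≈1 ind) (¬n≤m ∘ s≤s)
    split : ¬ ((∀ i → u i zero ≈ 0#) ⊎ ∃ λ i → ¬ u i zero ≈ 0#)
    split (inj₁ col≈0)      = ¬¬-independent⇒≤ m (λ i → u i ∘ suc) (independent-tail u col≈0 ind)
                                                 (¬n≤m ∘ m≤n⇒m≤1+n)
    split (inj₂ (k , uk≉0)) = with-pivot u ind k uk≉0 ¬n≤m

  independent⇒≤ : ∀ {n m} (u : Fin n → Fin m → Carrier) → Independent u → n ≤ m
  independent⇒≤ {n} {m} u ind = decidable-stable (n ≤? m) (¬¬-independent⇒≤ m u ind)


module RootOfUnity {a b} (F : Field a b) (r : ℕ) .{{_ : NonZero r}}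
                   (z : Field.Carrier F) (prim : PrimitiveRoot F r z) where

  open import Data.Nat as ℕ using (ℕ; zero; suc; _≤_)
  open import Data.Nat.Properties using (≤-antisym)
  open import Data.Fin using (Fin)
  open import Data.Product using (_,_; proj₁; proj₂)
  open import Data.Maybe using (just; nothing)
  open import Data.List using (List; map)
  import Data.List.Relation.Unary.All as All
  import Data.List.Relation.Unary.All.Properties as All
  open import Function using (_∘_; _⇔_; mk⇔; Equivalence)
  open import Function.Construct.Composition using (_⇔-∘_)
  open import Relation.Nullary using (¬_)
  open import Relation.Binary.PropositionalEquality as ≡ using (_≡_)
  open Field F hiding (zero)
  open LinearAlgebra F
  open import Algebra.Properties.Semiring.Sum semiring
  open import Algebra.Properties.Ring ring using (-1*x≈-x; -‿distribˡ-*; x∙y⁻¹≈ε⇒x≈y)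
  open import Algebra.Properties.CommutativeSemigroup *-commutativeSemigroup using (x∙yz≈y∙xz)
  open import Relation.Binary.Reasoning.Setoid setoid
  open Elimination r

  pow-+ : ∀ m n → pow F z (m ℕ.+ n) ≈ pow F z m * pow F z n
  pow-+ zero    n = sym (*-identityˡ _)
  pow-+ (suc m) n = trans (*-congˡ (pow-+ m n)) (sym (*-assoc z _ _))

  fixed-point : ∀ {k x} → 0 ℕ.< k → k ℕ.< r → pow F z k * x ≈ x → x ≈ 0#
  fixed-point {k} {x} 0<k k<r zᵏx≈x = nonzero-cancel zᵏ-1≉0 (begin
    (pow F z k - 1#) * x         ≈⟨ distribʳ x _ _ ⟩
    pow F z k * x + - 1# * x     ≈⟨ +-cong zᵏx≈x (-1*x≈-x x) ⟩
    x - x                        ≈⟨ -‿inverseʳ x ⟩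
    0#                           ∎)
    where
    zᵏ-1≉0 : ¬ pow F z k - 1# ≈ 0#
    zᵏ-1≉0 = proj₂ prim k 0<k k<r ∘ x∙y⁻¹≈ε⇒x≈y _ _

  action : CyclicAction r a b
  action = record
    { setoid     = setoid
    ; origin     = 0#
    ; _·_        = λ k x → pow F z k * x
    ; ·-cong     = λ k → *-congˡ
    ; ·-identity = *-identityˡ
    ; ·-assoc    = λ m n x → trans (sym (*-assoc _ _ x)) (*-congʳ (sym (pow-+ m n)))
    ; ·-period   = λ x → trans (*-congʳ (proj₁ prim)) (*-identityˡ x)
    ; ·-origin   = λ k → zeroʳ _
    ; ·-free     = fixed-point
    }

  open ActionProperties action using (≈⇔≈)
  open Solutions action

  normal : ∀ {ℓ} → Hyperplane ℓ → Vec F ℓ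
  normal (coord i)    = e F i
  normal (edge i j k) = λ m → e F i m + - (pow F z k * e F j m)

  dot-normal : ∀ {ℓ} i j k (x : Vec F ℓ) → dot F (normal (edge i j k)) x ≈ x i - pow F z k * x j
  dot-normal {ℓ} i j k x = begin
    dot F (normal (edge i j k)) x
      ≡⟨ dot≡sum (normal (edge i j k)) x ⟩
    ∑[ m < ℓ ] ((e F i m + - (pow F z k * e F j m)) * x m)
      ≈⟨ sum-cong-≋ term ⟩
    ∑[ m < ℓ ] (e F i m * x m + - pow F z k * (e F j m * x m))
      ≈⟨ ∑-distrib-+ (λ m → e F i m * x m) _ ⟩
    ∑[ m < ℓ ] (e F i m * x m) + ∑[ m < ℓ ] (- pow F z k * (e F j m * x m))
      ≈⟨ +-cong (sum-e i x) (sym (*-distribˡ-sum (- pow F z k) (λ m → e F j m * x m))) ⟩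
    x i + - pow F z k * ∑[ m < ℓ ] (e F j m * x m)
      ≈⟨ +-congˡ (trans (*-congˡ (sum-e j x)) (sym (-‿distribˡ-* _ _))) ⟩
    x i - pow F z k * x j ∎
    where
    term : ∀ m → (e F i m + - (pow F z k * e F j m)) * x m ≈ e F i m * x m + - pow F z k * (e F j m * x m)
    term m = trans (distribʳ (x m) _ _)
                   (+-congˡ (trans (*-congʳ (-‿distribˡ-* _ _)) (*-assoc _ _ _)))

  on⇔dot≈0 : ∀ {ℓ} (h : Hyperplane ℓ) x → OnHyperplane h x ⇔ dot F (normal h) x ≈ 0#
  on⇔dot≈0 (coord i) x = ≈⇔≈ (sym (trans (reflexive (dot≡sum (e F i) x)) (sum-e i x))) refl
  on⇔dot≈0 (edge i j k) x = ≈⇔≈ (sym (dot-normal i j k x)) refl ⇔-∘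
    mk⇔ (λ eq → trans (+-congʳ eq) (-‿inverseʳ _)) (x∙y⁻¹≈ε⇒x≈y _ _)

  solves⇔∈intersection : ∀ {ℓ} (S : List (Hyperplane ℓ)) x →
                         Solves (proj₂ (run S)) x ⇔ InIntersection F (map normal S) x
  solves⇔∈intersection S x = mk⇔
    (λ sol → All.map⁺ (All.map (λ {h} → Equivalence.to (on⇔dot≈0 h x)) (Equivalence.to (run-correct S x) sol)))
    (λ x∈ → Equivalence.from (run-correct S x) (All.map (λ {h} → Equivalence.from (on⇔dot≈0 h x)) (All.map⁻ x∈)))

  ⟦⟧-linear : ∀ {n d} (u : Monomial d) (c : Fin n → Carrier) (y : Fin n → Fin d → Carrier) →
              ∑[ i < n ] (c i * ⟦ u ⟧ (y i)) ≈ ⟦ u ⟧ (λ p → ∑[ i < n ] (c i * y i p))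
  ⟦⟧-linear nothing        c y = sum-zero (λ i → zeroʳ (c i))
  ⟦⟧-linear (just (p , k)) c y = begin
    ∑[ i < _ ] (c i * (pow F z k * y i p))   ≈⟨ sum-cong-≋ (λ i → x∙yz≈y∙xz (c i) _ (y i p)) ⟩
    ∑[ i < _ ] (pow F z k * (c i * y i p))   ≈⟨ *-distribˡ-sum (pow F z k) (λ i → c i * y i p) ⟨
    pow F z k * ∑[ i < _ ] (c i * y i p)     ∎

  ⟦⟧-zero : ∀ {d} (u : Monomial d) → ⟦ u ⟧ (λ _ → 0#) ≈ 0#
  ⟦⟧-zero nothing        = refl
  ⟦⟧-zero (just (_ , k)) = zeroʳ _

  -- x ↦ x ∘ pivot E identifies the intersection with K^(rank S), with inverse expand E.
  dimension≤rank : ∀ {ℓ} (S : List (Hyperplane ℓ)) {n} → IsDimOfIntersection F (map normal S) n → n ≤ rank S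
  dimension≤rank S {n} (v , v∈ , v-independent , _) = independent⇒≤ restricted restricted-independent
    where
    E = proj₂ (run S)
    restricted : Fin n → Fin (rank S) → Carrier
    restricted i = v i ∘ pivot E
    solves : ∀ i → Solves E (v i)
    solves i = Equivalence.from (solves⇔∈intersection S (v i)) (v∈ i)
    restricted-independent : Independent restricted
    restricted-independent c c·v≈0 = v-independent c λ m → begin
      Σᶠ F (λ i → c i * v i m)                                 ≡⟨ Σᶠ≡sum (λ i → c i * v i m) ⟩
      ∑[ i < n ] (c i * v i m)                                 ≈⟨ sum-cong-≋ (λ i → *-congˡ (solves i m)) ⟩
      ∑[ i < n ] (c i * ⟦ coeff E m ⟧ (restricted i))          ≈⟨ ⟦⟧-linear (coeff E m) c restricted ⟩
      ⟦ coeff E m ⟧ (λ p → ∑[ i < n ] (c i * restricted i p))  ≈⟨ ⟦⟧-cong (coeff E m) c·v≈0 ⟩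
      ⟦ coeff E m ⟧ (λ _ → 0#)                                 ≈⟨ ⟦⟧-zero (coeff E m) ⟩
      0#                                                       ∎

  rank≤dimension : ∀ {ℓ} (S : List (Hyperplane ℓ)) {n} → IsDimOfIntersection F (map normal S) n → rank S ≤ n
  rank≤dimension {ℓ} S {n} (v , _ , _ , v-spans) = independent⇒≤ coordinates coordinates-independent
    where
    E = proj₂ (run S)
    d = rank S
    basis : Fin d → Vec F ℓ
    basis p = expand E (λ q → e F q p)
    coordinates : Fin d → Fin n → Carrier
    coordinates p = proj₁ (v-spans (basis p) (Equivalence.to (solves⇔∈intersection S _) (solves-expand E _)))
    coordinates-independent : Independent coordinates
    coordinates-independent c c·C≈0 q = begin
      c q                                                      ≈⟨ sum-e q c ⟨
      ∑[ p < d ] (e F q p * c p)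
        ≈⟨ sum-cong-≋ (λ p → *-congʳ (sym (expand-pivot E (λ q′ → e F q′ p) q))) ⟩
      ∑[ p < d ] (basis p (pivot E q) * c p)
        ≈⟨ sum-cong-≋ (λ p → *-congʳ (trans (proj₂ (v-spans _ _) (pivot E q))
                                            (reflexive (Σᶠ≡sum (λ i → coordinates p i * w i))))) ⟩
      ∑[ p < d ] (∑[ i < n ] (coordinates p i * w i) * c p)
        ≈⟨ sum-cong-≋ (λ p → *-distribʳ-sum (c p) (λ i → coordinates p i * w i)) ⟩
      ∑[ p < d ] ∑[ i < n ] ((coordinates p i * w i) * c p)    ≈⟨ ∑-comm (λ p i → (coordinates p i * w i) * c p) ⟩
      ∑[ i < n ] ∑[ p < d ] ((coordinates p i * w i) * c p)
        ≈⟨ sum-cong-≋ (λ i → sum-cong-≋ (λ p → rearrange (coordinates p i) (w i) (c p))) ⟩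
      ∑[ i < n ] ∑[ p < d ] ((c p * coordinates p i) * w i)
        ≈⟨ sum-cong-≋ (λ i → *-distribʳ-sum (w i) (λ p → c p * coordinates p i)) ⟨
      ∑[ i < n ] (∑[ p < d ] (c p * coordinates p i) * w i)
        ≈⟨ sum-zero (λ i → trans (*-congʳ (c·C≈0 i)) (zeroˡ (w i))) ⟩
      0#                                                       ∎
      where
      w : Fin n → Carrier
      w i = v i (pivot E q)
      rearrange : ∀ x y t → (x * y) * t ≈ (t * x) * y
      rearrange x y t = trans (*-comm _ t) (sym (*-assoc t x y))

  rank≡dimension : ∀ {ℓ} (S : List (Hyperplane ℓ)) {n} → IsDimOfIntersection F (map normal S) n → n ≡ rank S
  rank≡dimension S dim = ≤-antisym (dimension≤rank S dim) (rank≤dimension S dim)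


module Graphs where

  open import Data.Bool using (Bool; true; false; T; not; _∧_; _∨_)
  open import Data.Bool.Properties using (T-∧)
  open import Data.Bool.ListAction using (and)
  open import Data.Nat using (ℕ; suc; _<_; _<ᵇ_)
  open import Data.Nat.Properties using (<⇒<ᵇ)
  open import Data.Fin using (Fin; toℕ)
  open import Data.Fin.Properties using (_≟_)
  open import Data.Product using (_×_; _,_; proj₂)
  open import Data.Unit using (tt)
  open import Data.List using (List; []; _∷_; _++_; map; concatMap; allFin; upTo)
  open import Data.List.Relation.Unary.All as All using (All; []; _∷_)
  import Data.List.Relation.Unary.All.Properties as All
  open import Data.List.Membership.Propositional using (_∈_; find; lose)
  open import Data.List.Membership.Propositional.Properties
    using (∈-map⁺; ∈-map⁻; ∈-concatMap⁺; ∈-concatMap⁻; ∈-++⁺ˡ; ∈-++⁺ʳ; ∈-allFin; ∈-filter⁺; ∈-filter⁻; ∈-upTo⁺)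
  open import Function using (_∘_; _⇔_; mk⇔; Equivalence)
  open import Relation.Nullary using (yes; no; does; T?)
  open import Relation.Binary.PropositionalEquality using (_≡_; _≢_; refl; sym; trans)

  T-and : ∀ bs → T (and bs) ⇔ All T bs
  T-and []       = mk⇔ (λ _ → []) (λ _ → tt)
  T-and (b ∷ bs) = mk⇔
    (λ t → let tb , tbs = Equivalence.to T-∧ t in tb ∷ Equivalence.to (T-and bs) tbs)
    (λ { (tb ∷ tbs) → Equivalence.from T-∧ (tb , Equivalence.from (T-and bs) tbs) })

  module _ {ℓ} (G : SimpleGraph ℓ) where

    edgeHyperplanes : ℕ → Fin ℓ × Fin ℓ → List (Hyperplane ℓ)
    edgeHyperplanes r (i , j) = map (edge i j) (map suc (upTo r))

    hyperplanes : ℕ → List (Hyperplane ℓ)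
    hyperplanes r = concatMap (edgeHyperplanes r) (edges G) ++ map coord (allFin ℓ)

    Proper : ∀ {c} → (Fin ℓ → Fin c) → Set
    Proper f = ∀ i j → T (adj G i j) → f i ≢ f j

    Proper-resp : ∀ {c} {f f′ : Fin ℓ → Fin c} → (∀ i → f i ≡ f′ i) → Proper f → Proper f′
    Proper-resp f≗f′ proper i j i~j same = proper i j i~j (trans (f≗f′ i) (trans same (sym (f≗f′ j))))

    private
      later? : Fin ℓ → Fin ℓ → Bool
      later? i j = (toℕ i <ᵇ toℕ j) ∧ adj G i j

    ∈-edges⁺ : ∀ {i j} → toℕ i < toℕ j → T (adj G i j) → (i , j) ∈ edges G
    ∈-edges⁺ {i} {j} i<j i~j = ∈-concatMap⁺ _ (lose (∈-allFin i) (∈-map⁺ (i ,_)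
      (∈-filter⁺ (T? ∘ later? i) (∈-allFin j) (Equivalence.from T-∧ (<⇒<ᵇ i<j , i~j)))))

    ∈-edges⁻ : ∀ {i j} → (i , j) ∈ edges G → T (adj G i j)
    ∈-edges⁻ ij∈ with find (∈-concatMap⁻ _ {xs = allFin ℓ} ij∈)
    ... | i , _ , ij∈ᵢ with ∈-map⁻ (i ,_) ij∈ᵢ
    ...   | j , j∈ , refl = proj₂ (Equivalence.to T-∧ (proj₂ (∈-filter⁻ (T? ∘ later? i) {xs = allFin ℓ} j∈)))

    coord∈hyperplanes : ∀ r i → coord i ∈ hyperplanes r
    coord∈hyperplanes r i = ∈-++⁺ʳ _ (∈-map⁺ coord (∈-allFin i))

    edge∈hyperplanes : ∀ {r i j k} → toℕ i < toℕ j → T (adj G i j) → k < r → edge i j (suc k) ∈ hyperplanes r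
    edge∈hyperplanes {i = i} {j} i<j i~j k<r = ∈-++⁺ˡ (∈-concatMap⁺ (edgeHyperplanes _)
      (lose (∈-edges⁺ i<j i~j) (∈-map⁺ (edge i j) (∈-map⁺ suc (∈-upTo⁺ k<r)))))

    all-hyperplanes : ∀ {p} {P : Hyperplane ℓ → Set p} r → (∀ i → P (coord i)) →
                      (∀ i j k → T (adj G i j) → P (edge i j k)) → All P (hyperplanes r)
    all-hyperplanes r P-coord P-edge = All.++⁺
      (All.concat⁺ (All.map⁺ {f = edgeHyperplanes r} (All.tabulate λ {(i , j)} ij∈ →
        All.map⁺ (All.universal (λ k → P-edge i j k (∈-edges⁻ ij∈)) (map suc (upTo r))))))
      (All.map⁺ (All.universal P-coord (allFin ℓ)))

    isProper-correct : ∀ {c} (f : Fin ℓ → Fin c) → T (isProper G f) ⇔ Proper f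
    isProper-correct f = mk⇔
      (λ t i j → Equivalence.to (clause (adj G i j) (f i ≟ f j))
        (All.lookup (Equivalence.to (T-and _) t) (∈-concatMap⁺ _ (lose (∈-allFin i) (∈-map⁺ _ (∈-allFin j))))))
      (λ proper → Equivalence.from (T-and _) (All.concat⁺ (All.map⁺ (All.universal (λ i →
        All.map⁺ (All.universal (λ j → Equivalence.from (clause (adj G i j) (f i ≟ f j)) (proper i j))
                                (allFin ℓ))) (allFin ℓ)))))
      where
      clause : ∀ {A : Set} {x y : A} a d → T (not a ∨ not (does d)) ⇔ (T a → x ≢ y)
      clause false d         = mk⇔ (λ _ ()) (λ _ → tt)
      clause true  (yes x≡y) = mk⇔ (λ ()) (λ x≢y → x≢y tt x≡y)
      clause true  (no x≢y)  = mk⇔ (λ _ _ → x≢y) (λ _ → tt)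


open Summation
open Enumeration
open Graphs

module Residues (r : ℕ) .{{_ : NonZero r}} where

  open import Data.Nat using (suc; _+_; _*_; _∸_; _<_; _%_; _/_; >-nonZero)
  open import Data.Nat.Properties using (+-assoc; +-comm; +-suc; +-identityʳ; +-cancelˡ-≡; <⇒≱; m∸n+n≡m)
  open import Data.Nat.DivMod using (_mod_; %-distribˡ-+; m%n%n≡m%n; [m+n]%n≡m%n; m<n⇒m%n≡m; m≡m%n+[m/n]*n; m%n<n)
  open import Data.Nat.Divisibility using (divides; ∣⇒≤)
  open import Data.Fin using (Fin; toℕ)
  open import Data.Fin.Properties using (toℕ-injective; toℕ-fromℕ<; toℕ<n)
  open import Data.Product using (∃; _×_; _,_)
  open import Relation.Binary.PropositionalEquality using (_≡_; _≢_; sym; trans; cong; module ≡-Reasoning)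

  _⊕_ : Fin r → ℕ → Fin r
  g ⊕ k = (toℕ g + k) mod r

  toℕ-⊕ : ∀ g k → toℕ (g ⊕ k) ≡ (toℕ g + k) % r
  toℕ-⊕ g k = toℕ-fromℕ< (m%n<n (toℕ g + k) r)

  [m%r+n]%r : ∀ m n → (m % r + n) % r ≡ (m + n) % r
  [m%r+n]%r m n = begin
    (m % r + n) % r           ≡⟨ %-distribˡ-+ (m % r) n r ⟩
    (m % r % r + n % r) % r   ≡⟨ cong (λ t → (t + n % r) % r) (m%n%n≡m%n m r) ⟩
    (m % r + n % r) % r       ≡⟨ %-distribˡ-+ m n r ⟨
    (m + n) % r               ∎
    where open ≡-Reasoning

  ⊕-identity : ∀ g → g ⊕ 0 ≡ g
  ⊕-identity g =
    toℕ-injective (trans (toℕ-⊕ g 0) (trans (cong (_% r) (+-identityʳ (toℕ g))) (m<n⇒m%n≡m (toℕ<n g))))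

  ⊕-assoc : ∀ m n g → (g ⊕ n) ⊕ m ≡ g ⊕ (m + n)
  ⊕-assoc m n g = toℕ-injective (begin
    toℕ ((g ⊕ n) ⊕ m)              ≡⟨ toℕ-⊕ (g ⊕ n) m ⟩
    (toℕ (g ⊕ n) + m) % r          ≡⟨ cong (λ t → (t + m) % r) (toℕ-⊕ g n) ⟩
    ((toℕ g + n) % r + m) % r      ≡⟨ [m%r+n]%r (toℕ g + n) m ⟩
    (toℕ g + n + m) % r
      ≡⟨ cong (_% r) (trans (+-assoc (toℕ g) n m) (cong (_+_ (toℕ g)) (+-comm n m))) ⟩
    (toℕ g + (m + n)) % r          ≡⟨ toℕ-⊕ g (m + n) ⟨
    toℕ (g ⊕ (m + n))              ∎)
    where open ≡-Reasoning

  ⊕-period : ∀ g → g ⊕ r ≡ g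
  ⊕-period g = toℕ-injective (trans (toℕ-⊕ g r) (trans ([m+n]%n≡m%n (toℕ g) r) (m<n⇒m%n≡m (toℕ<n g))))

  ⊕-free : ∀ {k} g → 0 < k → k < r → g ⊕ k ≢ g
  ⊕-free {k} g 0<k k<r g⊕k≡g = <⇒≱ k<r (∣⇒≤ {{>-nonZero 0<k}} (divides ((toℕ g + k) / r) k≡qr))
    where
    k≡qr : k ≡ (toℕ g + k) / r * r
    k≡qr = +-cancelˡ-≡ (toℕ g) _ _ (trans (m≡m%n+[m/n]*n (toℕ g + k) r)
             (cong (_+ (toℕ g + k) / r * r) (trans (sym (toℕ-⊕ g k)) (cong toℕ g⊕k≡g))))

  -- g′ ⊕ (1 + k) with k < r runs through all of ℤ/r, as the exponents 1 … r of M(G,r) do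
  ⊕-reach : ∀ g g′ → ∃ λ k → k < r × g′ ⊕ suc k ≡ g
  ⊕-reach g g′ = k , m%n<n _ r , toℕ-injective (begin
    toℕ (g′ ⊕ suc k)                 ≡⟨ toℕ-⊕ g′ (suc k) ⟩
    (toℕ g′ + suc k) % r             ≡⟨ cong (_% r) (trans (+-comm (toℕ g′) (suc k)) (sym (+-suc k (toℕ g′)))) ⟩
    (k + suc (toℕ g′)) % r           ≡⟨ [m%r+n]%r (toℕ g + (r ∸ suc (toℕ g′))) (suc (toℕ g′)) ⟩
    (toℕ g + (r ∸ suc (toℕ g′)) + suc (toℕ g′)) % r
      ≡⟨ cong (_% r) (trans (+-assoc (toℕ g) _ _) (cong (_+_ (toℕ g)) (m∸n+n≡m (toℕ<n g′)))) ⟩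
    (toℕ g + r) % r                  ≡⟨ [m+n]%n≡m%n (toℕ g) r ⟩
    toℕ g % r                        ≡⟨ m<n⇒m%n≡m (toℕ<n g) ⟩
    toℕ g                            ∎)
    where
    open ≡-Reasoning
    k = (toℕ g + (r ∸ suc (toℕ g′))) % r


module Colourings (r : ℕ) .{{_ : NonZero r}} (c : ℕ) where

  open import Level using (0ℓ)
  open import Data.Bool using (T)
  open import Data.Nat as ℕ using (zero; suc; _+_; _*_; _^_)
  open import Data.Nat.Properties using (+-comm; <-cmp)
  open import Data.Integer as ℤ using (+_; 0ℤ)
  import Data.Integer.Properties as ℤ
  open import Data.Fin using (Fin; zero; suc; toℕ)
  open import Data.Fin.Properties using (_≟_; toℕ-injective)
  open import Data.Product using (∃; ∃₂; _×_; _,_; proj₁; proj₂)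
  import Data.Product.Properties as Product
  open import Data.Maybe using (Maybe; just; nothing)
  import Data.Maybe.Properties as Maybe
  open import Data.List using (List; _∷_; map; allFin; cartesianProduct; length)
  import Data.List.Properties as List
  open import Data.List.Relation.Unary.All as All using (All; all?)
  import Data.Vec.Functional as Vector
  import Data.Vec.Functional.Relation.Binary.Pointwise.Properties as Pointwise
  open import Function using (_∘_; _⇔_; mk⇔; Equivalence; case_of_)
  open import Relation.Unary as U using (Pred)
  open import Relation.Binary using (DecidableEquality)
  open import Relation.Binary.Definitions using (tri<; tri≈; tri>)
  open import Relation.Nullary using (Dec; ¬_; ¬?; contradiction; T?)
  import Relation.Nullary.Decidable as Dec
  open import Relation.Binary.PropositionalEquality as ≡
    using (_≡_; _≢_; refl; sym; trans; cong; cong₂; subst; module ≡-Reasoning)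
  open Residues r

  -- The finite model {0} ⊎ (ℤ/r × [c]): 0, or a power of z together with a colour.
  Point : Set
  Point = Maybe (Fin r × Fin c)

  _≟ᴾ_ : DecidableEquality Point
  _≟ᴾ_ = Maybe.≡-dec (Product.≡-dec _≟_ _≟_)

  pairs : List (Fin r × Fin c)
  pairs = cartesianProduct (allFin r) (allFin c)

  points : List Point
  points = nothing ∷ map just pairs

  points-enumerate : Enumerates _≟ᴾ_ points
  points-enumerate =
    maybe-enumerates pairs
      (cartesianProduct-enumerates (allFin r) (allFin c) (allFin-enumerates r) (allFin-enumerates c))

  length-points : length points ≡ r * c + 1
  length-points = begin
    suc (length (map just pairs))                ≡⟨ cong suc (List.length-map just pairs) ⟩
    suc (length pairs)                           ≡⟨ cong suc (length-cartesianProduct (allFin r) (allFin c)) ⟩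
    suc (length (allFin r) * length (allFin c))  ≡⟨ cong₂ (λ m n → suc (m * n)) (length-allFin r) (length-allFin c) ⟩
    suc (r * c)                                  ≡⟨ +-comm 1 (r * c) ⟩
    r * c + 1                                    ∎
    where open ≡-Reasoning

  _·_ : ℕ → Point → Point
  k · nothing        = nothing
  k · just (g , col) = just (g ⊕ k , col)

  action : CyclicAction r 0ℓ 0ℓ
  action = record
    { setoid     = ≡.setoid Point
    ; origin     = nothing
    ; _·_        = _·_
    ; ·-cong     = λ k → cong (k ·_)
    ; ·-identity = λ { nothing → refl ; (just (g , col)) → cong (λ h → just (h , col)) (⊕-identity g) }
    ; ·-assoc    = λ { m n nothing → refl ; m n (just (g , col)) → cong (λ h → just (h , col)) (⊕-assoc m n g) }
    ; ·-period   = λ { nothing → refl ; (just (g , col)) → cong (λ h → just (h , col)) (⊕-period g) }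
    ; ·-origin   = λ _ → refl
    ; ·-free     = λ { {x = nothing} _ _ _ → refl
                     ; {x = just (g , col)} 0<k k<r eq →
                         contradiction (cong proj₁ (Maybe.just-injective eq)) (⊕-free g 0<k k<r) }
    }

  open Elimination r
  open Solutions action

  on? : ∀ {ℓ} (h : Hyperplane ℓ) x → Dec (OnHyperplane h x)
  on? (coord i)    x = x i ≟ᴾ nothing
  on? (edge i j k) x = x i ≟ᴾ (k · x j)

  count-solutions : ∀ {ℓ} (S : List (Hyperplane ℓ)) →
                    ∑[ x ∈ tuples points ℓ ] 𝟙 (all? (λ h → on? h x) S) ≡ (+ (r * c + 1)) ℤ.^ rank S
  count-solutions {ℓ} S = begin
    ∑[ x ∈ tuples points ℓ ] 𝟙 (all? (λ h → on? h x) S)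
      ≡⟨ count-by-parametrisation (Pointwise.decidable _≟ᴾ_) (Pointwise.decidable _≟ᴾ_)
           (tuples points ℓ) (tuples points (rank S))
           (tuples-enumerate _≟ᴾ_ points points-enumerate ℓ) (tuples-enumerate _≟ᴾ_ points points-enumerate (rank S))
           (λ x → all? (λ h → on? h x) S) (expand E) (_∘ pivot E) parametrisation ⟩
    + length (tuples points (rank S))
      ≡⟨ cong +_ (trans (length-tuples points (rank S)) (cong (_^ rank S) length-points)) ⟩
    + ((r * c + 1) ^ rank S)
      ≡⟨ pos-^ (r * c + 1) (rank S) ⟩
    (+ (r * c + 1)) ℤ.^ rank S ∎
    where
    open ≡-Reasoning
    E = proj₂ (run S)
    parametrisation : ∀ x y → (∀ m → x m ≡ expand E y m) ⇔ (All (λ h → OnHyperplane h x) S × ∀ p → y p ≡ x (pivot E p))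
    parametrisation x y = mk⇔
      (λ x≡ → let sol , y≡ = Equivalence.to (≈expand⇔ E x y) x≡ in Equivalence.to (run-correct S x) sol , y≡)
      (λ (on , y≡) → Equivalence.from (≈expand⇔ E x y) (Equivalence.from (run-correct S x) on , y≡))

  _HasColours_ : ∀ {ℓ} → (Fin ℓ → Point) → (Fin ℓ → Fin c) → Set
  x HasColours f = ∀ i → ∃ λ g → x i ≡ just (g , f i)

  ∑-allFuns-suc : ∀ {ℓ} (h : (Fin (suc ℓ) → Fin c) → ℤ.ℤ) → (∀ {f f′} → (∀ i → f i ≡ f′ i) → h f ≡ h f′) →
                  ∑[ f ∈ allFuns (suc ℓ) c ] h f ≡ ∑[ col ∈ allFin c ] ∑[ f ∈ allFuns ℓ c ] h (col Vector.∷ f)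
  ∑-allFuns-suc {ℓ} h h-cong = trans (∑-concatMap _ (allFin c) h) (∑-cong (allFin c) λ col →
    trans (∑-map _ (allFuns ℓ c) h) (∑-cong (allFuns ℓ c) λ f → h-cong λ { zero → refl ; (suc i) → refl }))

  count-by-colours : ∀ ℓ {p q} {Φ : Pred (Fin ℓ → Point) p} {Q : Pred (Fin ℓ → Fin c) q}
                     (Φ? : U.Decidable Φ) (Q? : U.Decidable Q) →
                     (∀ {f f′} → (∀ i → f i ≡ f′ i) → Q f → Q f′) →
                     (∀ x → Φ x ⇔ ∃ λ f → x HasColours f × Q f) →
                     ∑[ x ∈ tuples points ℓ ] 𝟙 (Φ? x) ≡ + (r ^ ℓ) ℤ.* ∑[ f ∈ allFuns ℓ c ] 𝟙 (Q? f)
  count-by-colours zero Φ? Q? Q-resp Φ⇔ = trans (cong (ℤ._+ 0ℤ) (empty _)) (sym (ℤ.*-identityˡ _))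
    where
    empty : ∀ f₀ → 𝟙 (Φ? Vector.[]) ≡ 𝟙 (Q? f₀)
    empty f₀ = 𝟙-⇔ (Φ? Vector.[]) (Q? f₀) (mk⇔
      (λ φ → let f , _ , q = Equivalence.to (Φ⇔ Vector.[]) φ in Q-resp {f} {f₀} (λ ()) q)
      (λ q → Equivalence.from (Φ⇔ Vector.[]) (f₀ , (λ ()) , q)))
  count-by-colours (suc ℓ) Φ? Q? Q-resp Φ⇔ = begin
    ∑[ x ∈ tuples points (suc ℓ) ] 𝟙 (Φ? x)
      ≡⟨ ∑-tuples-suc points ℓ (𝟙 ∘ Φ?) ⟩
    ∑[ x ∈ xs ] 𝟙 (Φ? (nothing Vector.∷ x)) ℤ.+ ∑ (map just pairs) (λ p → ∑[ x ∈ xs ] 𝟙 (Φ? (p Vector.∷ x)))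
      ≡⟨ cong₂ ℤ._+_ (∑-zero xs uncoloured) (trans (∑-map just pairs _) (∑-cartesianProduct (allFin r) (allFin c) _)) ⟩
    0ℤ ℤ.+ ∑[ g ∈ allFin r ] ∑[ col ∈ allFin c ] ∑[ x ∈ xs ] 𝟙 (Φ? (just (g , col) Vector.∷ x))
      ≡⟨ trans (ℤ.+-identityˡ _) (∑-cong (allFin r) λ g → ∑-cong (allFin c) (restrict g)) ⟩
    ∑[ g ∈ allFin r ] ∑[ col ∈ allFin c ] (+ (r ^ ℓ) ℤ.* ∑[ f ∈ allFuns ℓ c ] 𝟙 (Q? (col Vector.∷ f)))
      ≡⟨ ∑-cong (allFin r) (λ g → ∑-distribˡ (allFin c) (+ (r ^ ℓ)) _) ⟩
    ∑[ g ∈ allFin r ] (+ (r ^ ℓ) ℤ.* N)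
      ≡⟨ ∑-const (allFin r) _ ⟩
    + length (allFin r) ℤ.* (+ (r ^ ℓ) ℤ.* N)
      ≡⟨ cong (λ n → + n ℤ.* (+ (r ^ ℓ) ℤ.* N)) (length-allFin r) ⟩
    + r ℤ.* (+ (r ^ ℓ) ℤ.* N)
      ≡⟨ trans (sym (ℤ.*-assoc (+ r) (+ (r ^ ℓ)) N)) (cong (ℤ._* N) (sym (ℤ.pos-* r (r ^ ℓ)))) ⟩
    + (r ^ suc ℓ) ℤ.* N
      ≡⟨ cong (+ (r ^ suc ℓ) ℤ.*_) (∑-allFuns-suc (𝟙 ∘ Q?) λ {f} {f′} f≗f′ →
           𝟙-⇔ (Q? f) (Q? f′) (mk⇔ (Q-resp f≗f′) (Q-resp (sym ∘ f≗f′)))) ⟨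
    + (r ^ suc ℓ) ℤ.* ∑[ f ∈ allFuns (suc ℓ) c ] 𝟙 (Q? f) ∎
    where
    open ≡-Reasoning
    xs = tuples points ℓ
    N = ∑[ col ∈ allFin c ] ∑[ f ∈ allFuns ℓ c ] 𝟙 (Q? (col Vector.∷ f))
    uncoloured : ∀ x → 𝟙 (Φ? (nothing Vector.∷ x)) ≡ 0ℤ
    uncoloured x = 𝟙-false (Φ? _) λ φ → case Equivalence.to (Φ⇔ _) φ of λ where
      (_ , coloured , _) → case coloured zero of λ where (_ , ())
    restrict : ∀ g col → ∑[ x ∈ xs ] 𝟙 (Φ? (just (g , col) Vector.∷ x))
                         ≡ + (r ^ ℓ) ℤ.* ∑[ f ∈ allFuns ℓ c ] 𝟙 (Q? (col Vector.∷ f))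
    restrict g col = count-by-colours ℓ (λ x → Φ? (just (g , col) Vector.∷ x)) (λ f → Q? (col Vector.∷ f))
      (λ f≗f′ → Q-resp λ { zero → refl ; (suc i) → f≗f′ i })
      (λ x → mk⇔
        (λ φ → let f , coloured , q = Equivalence.to (Φ⇔ _) φ
               in f ∘ suc , coloured ∘ suc , Q-resp (λ { zero → head-colour (coloured zero) ; (suc i) → refl }) q)
        (λ (f , coloured , q) →
          Equivalence.from (Φ⇔ _) (col Vector.∷ f , (λ { zero → g , refl ; (suc i) → coloured i }) , q)))
      where
      head-colour : ∀ {col′} → (∃ λ g′ → just (g , col) ≡ just (g′ , col′)) → col′ ≡ col
      head-colour (_ , refl) = refl

  module _ {ℓ} (G : SimpleGraph ℓ) where

    Avoids : (Fin ℓ → Point) → Set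
    Avoids x = All (λ h → ¬ OnHyperplane h x) (hyperplanes G r)

    avoids⇒coloured : ∀ x → Avoids x → ∃ λ f → x HasColours f × Proper G f
    avoids⇒coloured x avoids = colour , coloured , proper
      where
      split : ∀ i → ∃₂ λ g col → x i ≡ just (g , col)
      split i with x i | All.lookup avoids (coord∈hyperplanes G r i)
      ... | nothing        | x≢0 = contradiction refl x≢0
      ... | just (g , col) | _   = g , col , refl
      colour : Fin ℓ → Fin c
      colour i = proj₁ (proj₂ (split i))
      coloured : x HasColours colour
      coloured i = proj₁ (split i) , proj₂ (proj₂ (split i))
      collide : ∀ {i j} → toℕ i ℕ.< toℕ j → T (adj G i j) → colour i ≢ colour j
      collide {i} {j} i<j i~j same with ⊕-reach (proj₁ (split i)) (proj₁ (split j))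
      ... | k , k<r , reach = All.lookup avoids (edge∈hyperplanes G i<j i~j k<r) (begin
        x i                                          ≡⟨ proj₂ (coloured i) ⟩
        just (proj₁ (split i) , colour i)            ≡⟨ cong₂ (λ g col → just (g , col)) (sym reach) same ⟩
        just (proj₁ (split j) ⊕ suc k , colour j)    ≡⟨ cong (suc k ·_) (proj₂ (coloured j)) ⟨
        suc k · x j                                  ∎)
        where open ≡-Reasoning
      proper : Proper G colour
      proper i j i~j same with <-cmp (toℕ i) (toℕ j)
      ... | tri< i<j _ _ = collide i<j i~j same
      ... | tri> _ _ j<i = collide j<i (subst T (adj-sym G i j) i~j) (sym same)
      ... | tri≈ _ i≡j _ = subst T (adj-irrefl G i) (subst (T ∘ adj G i) (sym (toℕ-injective i≡j)) i~j)

    coloured⇒avoids : ∀ x → (∃ λ f → x HasColours f × Proper G f) → Avoids x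
    coloured⇒avoids x (f , coloured , proper) = all-hyperplanes G r
      (λ i x≡0 → case trans (sym x≡0) (proj₂ (coloured i)) of λ ())
      (λ i j k i~j x≡ → proper i j i~j (cong proj₂ (Maybe.just-injective (begin
        just (proj₁ (coloured i) , f i)        ≡⟨ proj₂ (coloured i) ⟨
        x i                                    ≡⟨ x≡ ⟩
        k · x j                                ≡⟨ cong (k ·_) (proj₂ (coloured j)) ⟩
        just (proj₁ (coloured j) ⊕ k , f j)    ∎))))
      where open ≡-Reasoning

    proper? : U.Decidable (Proper G {c})
    proper? f = Dec.map (isProper-correct G f) (T? (isProper G f))

    count-avoiding : ∑[ x ∈ tuples points ℓ ] 𝟙 (all? (λ h → ¬? (on? h x)) (hyperplanes G r))
                     ≡ + (r ^ ℓ * chromaticAt G c)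
    count-avoiding = begin
      ∑[ x ∈ tuples points ℓ ] 𝟙 (all? (λ h → ¬? (on? h x)) (hyperplanes G r))
        ≡⟨ count-by-colours ℓ (λ x → all? (λ h → ¬? (on? h x)) (hyperplanes G r)) proper? (Proper-resp G)
                            (λ x → mk⇔ (avoids⇒coloured x) (coloured⇒avoids x)) ⟩
      + (r ^ ℓ) ℤ.* ∑[ f ∈ allFuns ℓ c ] 𝟙 (proper? f)
        ≡⟨ cong (+ (r ^ ℓ) ℤ.*_) (∑-𝟙 (T? ∘ isProper G) (allFuns ℓ c)) ⟩
      + (r ^ ℓ) ℤ.* + chromaticAt G c
        ≡⟨ ℤ.pos-* (r ^ ℓ) (chromaticAt G c) ⟨
      + (r ^ ℓ * chromaticAt G c) ∎
      where open ≡-Reasoning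


open import Level using (Level)
open import Data.Nat as ℕ using (ℕ; _≤_; _+_; _*_; _^_; >-nonZero)
open import Data.Integer as ℤ using (+_)
open import Data.Product using (_,_)
open import Data.List using (List; []; _∷_; _++_; map; length; concatMap; allFin; upTo)
import Data.List.Properties as List
open import Data.List.Relation.Unary.All using (all?)
open import Function using (_∘_)
open import Relation.Nullary using (¬?)
open import Relation.Binary.PropositionalEquality using (_≡_; refl; sym; trans; cong; cong₂; module ≡-Reasoning)

sublists-map : ∀ {a b} {A : Set a} {B : Set b} (f : A → B) xs → sublists (map f xs) ≡ map (map f) (sublists xs)
sublists-map f []       = refl
sublists-map f (x ∷ xs) = begin
  sublists (map f xs) ++ map (f x ∷_) (sublists (map f xs))
    ≡⟨ cong (λ S → S ++ map (f x ∷_) S) (sublists-map f xs) ⟩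
  map (map f) (sublists xs) ++ map (f x ∷_) (map (map f) (sublists xs))
    ≡⟨ cong (map (map f) (sublists xs) ++_) (trans (sym (List.map-∘ (sublists xs))) (List.map-∘ (sublists xs))) ⟩
  map (map f) (sublists xs) ++ map (map f) (map (x ∷_) (sublists xs))
    ≡⟨ List.map-++ (map f) (sublists xs) _ ⟨
  map (map f) (sublists xs ++ map (x ∷_) (sublists xs)) ∎
  where open ≡-Reasoning

charPolyAt-map : ∀ {a b} {A : Set a} {B : Set b} (f : A → B) xs dim t →
  charPolyAt (map f xs) dim t ≡ ∑[ S ∈ sublists xs ] (sign (length S) ℤ.* t ℤ.^ dim (map f S))
charPolyAt-map f xs dim t = begin
  ∑ (sublists (map f xs)) term               ≡⟨ cong (λ Ss → ∑ Ss term) (sublists-map f xs) ⟩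
  ∑ (map (map f) (sublists xs)) term         ≡⟨ ∑-map (map f) (sublists xs) term ⟩
  ∑ (sublists xs) (term ∘ map f)
    ≡⟨ ∑-cong (sublists xs) (λ S → cong (λ n → sign n ℤ.* t ℤ.^ dim (map f S)) (List.length-map f S)) ⟩
  ∑[ S ∈ sublists xs ] (sign (length S) ℤ.* t ℤ.^ dim (map f S)) ∎
  where
  open ≡-Reasoning
  term = λ B → sign (length B) ℤ.* t ℤ.^ dim B

module _ {a b} (F : Field a b) (r : ℕ) .{{_ : NonZero r}} (z : Field.Carrier F) (prim : PrimitiveRoot F r z) where

  open RootOfUnity F r z prim using (normal; rank≡dimension)

  arrangement≡ : ∀ {ℓ} (G : SimpleGraph ℓ) → map normal (hyperplanes G r) ≡ arrangementM F G r z
  arrangement≡ {ℓ} G = begin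
    map normal (concatMap (edgeHyperplanes G r) (edges G) ++ map coord (allFin ℓ))
      ≡⟨ List.map-++ normal (concatMap (edgeHyperplanes G r) (edges G)) _ ⟩
    map normal (concatMap (edgeHyperplanes G r) (edges G)) ++ map normal (map coord (allFin ℓ))
      ≡⟨ cong₂ _++_ (trans (List.map-concatMap normal (edgeHyperplanes G r) (edges G))
                           (List.concatMap-cong (λ (i , j) → sym (List.map-∘ (map ℕ.suc (upTo r)))) (edges G)))
                    (sym (List.map-∘ (allFin ℓ))) ⟩
    arrangementM F G r z ∎
    where open ≡-Reasoning

  module _ (c : ℕ) where

    open Colourings r c using (points; on?; count-solutions)

    charPolyAt≡signed-count :
      ∀ {ℓ} (H : List (Hyperplane ℓ)) (dim : List (Vec F ℓ) → ℕ) → (∀ B → IsDimOfIntersection F B (dim B)) →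
      charPolyAt (map normal H) dim (+ (r * c + 1))
        ≡ ∑[ x ∈ tuples points ℓ ] ∑[ S ∈ sublists H ] (sign (length S) ℤ.* 𝟙 (all? (λ h → on? h x) S))
    charPolyAt≡signed-count {ℓ} H dim dim-correct = begin
      charPolyAt (map normal H) dim t
        ≡⟨ charPolyAt-map normal H dim t ⟩
      ∑[ S ∈ sublists H ] (sign (length S) ℤ.* t ℤ.^ dim (map normal S))
        ≡⟨ ∑-cong (sublists H) (λ S → cong (sign (length S) ℤ.*_) (power≡count S)) ⟩
      ∑[ S ∈ sublists H ] (sign (length S) ℤ.* ∑[ x ∈ Pℓ ] 𝟙 (all? (λ h → on? h x) S))
        ≡⟨ ∑-cong (sublists H) (λ S → ∑-distribˡ Pℓ (sign (length S)) _) ⟨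
      ∑[ S ∈ sublists H ] ∑[ x ∈ Pℓ ] (sign (length S) ℤ.* 𝟙 (all? (λ h → on? h x) S))
        ≡⟨ ∑-comm (sublists H) Pℓ _ ⟩
      ∑[ x ∈ Pℓ ] ∑[ S ∈ sublists H ] (sign (length S) ℤ.* 𝟙 (all? (λ h → on? h x) S)) ∎
      where
      open ≡-Reasoning
      t = + (r * c + 1)
      Pℓ = tuples points ℓ
      power≡count : ∀ S → t ℤ.^ dim (map normal S) ≡ ∑[ x ∈ Pℓ ] 𝟙 (all? (λ h → on? h x) S)
      power≡count S = trans (cong (t ℤ.^_) (rank≡dimension S (dim-correct (map normal S)))) (sym (count-solutions S))

mainTheorem6 : ∀ {a b : Level} (F : Field a b) (r : ℕ) → 1 ≤ r
    → (z : Field.Carrier F) → PrimitiveRoot F r z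
    → (ℓ : ℕ) (G : SimpleGraph ℓ)
    → (dim : List (Vec F ℓ) → ℕ)
    → (∀ B → IsDimOfIntersection F B (dim B))
    → ∀ (c : ℕ)
    → charPolyAt (arrangementM F G r z) dim (+ (r * c + 1))
    ≡ + (r ^ ℓ * chromaticAt G c)
mainTheorem6 F r 1≤r z prim ℓ G dim dim-correct c = begin
  charPolyAt (arrangementM F G r z) dim t
    ≡⟨ cong (λ A → charPolyAt A dim t) (arrangement≡ F r z prim G) ⟨
  charPolyAt (map normal H) dim t
    ≡⟨ charPolyAt≡signed-count F r z prim c H dim dim-correct ⟩
  ∑[ x ∈ Pℓ ] ∑[ S ∈ sublists H ] (sign (length S) ℤ.* 𝟙 (all? (λ h → on? h x) S))
    ≡⟨ ∑-cong Pℓ (λ x → inclusion-exclusion (λ h → on? h x) H) ⟩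
  ∑[ x ∈ Pℓ ] 𝟙 (all? (λ h → ¬? (on? h x)) H)
    ≡⟨ count-avoiding G ⟩
  + (r ^ ℓ * chromaticAt G c) ∎
  where
  open ≡-Reasoning
  instance
    r≢0 : NonZero r
    r≢0 = >-nonZero 1≤r
  open RootOfUnity F r z prim using (normal)
  open Colourings r c using (points; on?; count-avoiding)
  t = + (r * c + 1)
  H = hyperplanes G r
  Pℓ = tuples points ℓ
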